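{- Let $T_{\not\exists}$ be a set of $\exists$-free formulas and $A(\underline{z},\underline{w})$ a formula of $\mathcal{L}^\omega_*$ whose only free variables are among the tuples $\underline{z},\underline{w}$. If $$\mathrm{IL}^{\omega}_*+\mathrm{AC}^{\omega}_*+\mathrm{IP}^*_{\not\exists}+T_{\not\exists}\vdash\forall\underline{z}\exists\underline{w}\,A(\underline{z},\underline{w}),$$ then there exist closed terms $\underline{r}$ such that $$\mathrm{IL}^{\omega}_*+\mathrm{AC}^{\omega}_*+\mathrm{IP}^*_{\not\exists}+T_{\not\exists}\vdash\forall\underline{z}\exists\underline{w}\in\underline{r}\underline{z}\,A(\underline{z},\underline{w}).$$
   Context: Fix a first-order language $\mathcal{L}$ with at least one constant symbol. Types: $G$; $\sigma\to\tau$; $\sigma^*$. Constants: function symbols of $\mathcal{L}$; $\Pi_{\sigma,\tau}:\sigma\to\tau\to\sigma$; $\Sigma_{\rho,\sigma,\tau}:(\rho\to\sigma\to\tau)\to(\rho\to\sigma)\to\rho\to\tau$; $\mathfrak{s}_\sigma:\sigma\to\sigma^*$; $\cup_\sigma:\sigma^*\to\sigma^*\to\sigma^*$; $\bigcup_{\sigma,\tau}:\sigma^*\to(\sigma\to\tau^*)\to\tau^*$. Terms: constants, typed variables, applications. Atomic formulas: $\bot$, $t=_\rho q$, $t\in_\rho q$ ($q:\rho^*$), $R(t_1,\dots,t_n)$. Formulas of $\mathcal{L}^\omega_*$: closed under $\lor,\land,\to,\forall x,\exists x$ and bounded quantifiers $\forall x\in t,\exists x\in t$. A formula is $\exists$-free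 if it contains no unbounded $\exists x$. $\mathrm{IL}^{\omega}_*$ is intuitionistic predicate logic in all finite types with: $x=x$; $x=y\land A\to A'$ ($A$ atomic); $\forall x\in t\,A\leftrightarrow\forall x(x\in t\to A)$; $\exists x\in t\,A\leftrightarrow\exists x(x\in t\land A)$; $\Sigma xyz=xz(yz)$; $\Pi xy=x$; $w\in\mathfrak{s}x\leftrightarrow w=x$; $w\in\cup xy\leftrightarrow w\in x\lor w\in y$; $z\in x\land w\in yz\to w\in\bigcup xy$; $\bigcup(\mathfrak{s}x)y=yx$; $\bigcup(\cup xy)z=\cup(\bigcup xz)(\bigcup yz)$. $\mathrm{AC}^{\omega}_*$: $\forall x^\rho\exists y^\sigma A(x,y)\to\exists f^{\rho\to\sigma^*}\forall x\exists y\in fx\,A(x,y)$. $\mathrm{IP}^*_{\not\exists}$: $(B(x)\to\exists y\,A(y))\to\exists w(B(x)\to\exists y\in w\,A(y))$ for $\exists$-free $B$. For tuples, $\exists\underline{w}\in\underline{r}\underline{z}$ means $\exists w_1\in r_1\underline{z}\cdots\exists w_k\in r_k\underline{z}$. -}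

module Defs where

open import Data.Nat using (ℕ; zero; suc)
open import Data.List using (List; []; _∷_; _++_; map)
open import Data.List.Membership.Propositional using (_∈_)
open import Data.List.Relation.Unary.All using (All; []; _∷_)
open import Data.Vec using (Vec)
import Data.Vec as Vec

record Language : Set₁ where
  field
    Fun : ℕ → Set
    Rel : ℕ → Set
    const₀ : Fun 0

infixr 5 _⇒_
infix 10 _*

data Ty : Set where
  G   : Ty
  _⇒_ : Ty → Ty → Ty
  _*  : Ty → Ty

funTy : ℕ → Ty
funTy zero    = G
funTy (suc n) = G ⇒ funTy n

-- contexts (de Bruijn, head = innermost bound variable)
Ctx : Set
Ctx = List Ty

data _∋_ : Ctx → Ty → Set where
  here  : ∀ {Γ σ} → (σ ∷ Γ) ∋ σ
  there : ∀ {Γ σ τ} → Γ ∋ σ → (τ ∷ Γ) ∋ σ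

Ren : Ctx → Ctx → Set
Ren Γ Δ = ∀ {σ} → Γ ∋ σ → Δ ∋ σ

ext : ∀ {Γ Δ σ} → Ren Γ Δ → Ren (σ ∷ Γ) (σ ∷ Δ)
ext ρ here      = here
ext ρ (there x) = there (ρ x)

wkBy : ∀ {Zs} (Ws : Ctx) → Ren Zs (Ws ++ Zs)
wkBy []       x = x
wkBy (_ ∷ Ws) x = there (wkBy Ws x)

fromEmpty : ∀ {Γ} → Ren [] Γ
fromEmpty ()

-- curried type of a function of the variables in Zs (outermost first):
-- [z_n , ... , z_1] ⇛ τ  =  z_1 ⇒ ... ⇒ z_n ⇒ τ
infixr 4 _⇛_
_⇛_ : Ctx → Ty → Ty
[]       ⇛ τ = τ
(σ ∷ Δ) ⇛ τ = Δ ⇛ (σ ⇒ τ)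

module Syn (L : Language) where
  open Language L

  data Const : Ty → Set where
    fun    : ∀ {n} → Fun n → Const (funTy n)
    Πc     : ∀ σ τ → Const (σ ⇒ τ ⇒ σ)
    Σc     : ∀ ρ σ τ → Const ((ρ ⇒ σ ⇒ τ) ⇒ (ρ ⇒ σ) ⇒ ρ ⇒ τ)
    sng    : ∀ σ → Const (σ ⇒ σ *)
    cup    : ∀ σ → Const (σ * ⇒ σ * ⇒ σ *)
    bigcup : ∀ σ τ → Const (σ * ⇒ (σ ⇒ τ *) ⇒ τ *)

  infixl 9 _·_

  data Tm (Γ : Ctx) : Ty → Set where
    var : ∀ {σ} → Γ ∋ σ → Tm Γ σ
    con : ∀ {σ} → Const σ → Tm Γ σ
    _·_ : ∀ {σ τ} → Tm Γ (σ ⇒ τ) → Tm Γ σ → Tm Γ τ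

  infix 2 _⇔_
  infixr 3 _⊃_
  infixr 4 _∨'_
  infixr 5 _∧'_
  infix 6 _≐_ _∈'_

  data Fm : Ctx → Set where
    ⊥'   : ∀ {Γ} → Fm Γ
    _≐_  : ∀ {Γ ρ} → Tm Γ ρ → Tm Γ ρ → Fm Γ
    _∈'_ : ∀ {Γ ρ} → Tm Γ ρ → Tm Γ (ρ *) → Fm Γ
    rel  : ∀ {Γ n} → Rel n → Vec (Tm Γ G) n → Fm Γ
    _∨'_ : ∀ {Γ} → Fm Γ → Fm Γ → Fm Γ
    _∧'_ : ∀ {Γ} → Fm Γ → Fm Γ → Fm Γ
    _⊃_  : ∀ {Γ} → Fm Γ → Fm Γ → Fm Γ
    ∀'   : ∀ {Γ} σ → Fm (σ ∷ Γ) → Fm Γ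
    ∃'   : ∀ {Γ} σ → Fm (σ ∷ Γ) → Fm Γ
    ∀∈   : ∀ {Γ σ} → Tm Γ (σ *) → Fm (σ ∷ Γ) → Fm Γ
    ∃∈   : ∀ {Γ σ} → Tm Γ (σ *) → Fm (σ ∷ Γ) → Fm Γ

  _⇔_ : ∀ {Γ} → Fm Γ → Fm Γ → Fm Γ
  A ⇔ B = (A ⊃ B) ∧' (B ⊃ A)

  data Atomic {Γ} : Fm Γ → Set where
    at-⊥   : Atomic ⊥'
    at-≐   : ∀ {ρ} (t q : Tm Γ ρ) → Atomic (t ≐ q)
    at-∈   : ∀ {ρ} (t : Tm Γ ρ) (q : Tm Γ (ρ *)) → Atomic (t ∈' q)
    at-rel : ∀ {n} (R : Rel n) ts → Atomic (rel R ts)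

  data ExFree : ∀ {Γ} → Fm Γ → Set where
    ef-⊥   : ∀ {Γ} → ExFree {Γ} ⊥'
    ef-≐   : ∀ {Γ ρ} (t q : Tm Γ ρ) → ExFree (t ≐ q)
    ef-∈   : ∀ {Γ ρ} (t : Tm Γ ρ) (q : Tm Γ (ρ *)) → ExFree (t ∈' q)
    ef-rel : ∀ {Γ n} (R : Rel n) (ts : Vec (Tm Γ G) n) → ExFree (rel R ts)
    ef-∨   : ∀ {Γ} {A B : Fm Γ} → ExFree A → ExFree B → ExFree (A ∨' B)
    ef-∧   : ∀ {Γ} {A B : Fm Γ} → ExFree A → ExFree B → ExFree (A ∧' B)
    ef-⊃   : ∀ {Γ} {A B : Fm Γ} → ExFree A → ExFree B → ExFree (A ⊃ B)
    ef-∀   : ∀ {Γ σ} {A : Fm (σ ∷ Γ)} → ExFree A → ExFree (∀' σ A)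
    ef-∀∈  : ∀ {Γ σ} {t : Tm Γ (σ *)} {A : Fm (σ ∷ Γ)} → ExFree A → ExFree (∀∈ t A)
    ef-∃∈  : ∀ {Γ σ} {t : Tm Γ (σ *)} {A : Fm (σ ∷ Γ)} → ExFree A → ExFree (∃∈ t A)

  renTm : ∀ {Γ Δ σ} → Ren Γ Δ → Tm Γ σ → Tm Δ σ
  renTm ρ (var x) = var (ρ x)
  renTm ρ (con c) = con c
  renTm ρ (t · u) = renTm ρ t · renTm ρ u

  renFm : ∀ {Γ Δ} → Ren Γ Δ → Fm Γ → Fm Δ
  renFm ρ ⊥'         = ⊥'
  renFm ρ (t ≐ q)    = renTm ρ t ≐ renTm ρ q
  renFm ρ (t ∈' q)   = renTm ρ t ∈' renTm ρ q
  renFm ρ (rel R ts) = rel R (Vec.map (renTm ρ) ts)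
  renFm ρ (A ∨' B)   = renFm ρ A ∨' renFm ρ B
  renFm ρ (A ∧' B)   = renFm ρ A ∧' renFm ρ B
  renFm ρ (A ⊃ B)    = renFm ρ A ⊃ renFm ρ B
  renFm ρ (∀' σ A)   = ∀' σ (renFm (ext ρ) A)
  renFm ρ (∃' σ A)   = ∃' σ (renFm (ext ρ) A)
  renFm ρ (∀∈ t A)   = ∀∈ (renTm ρ t) (renFm (ext ρ) A)
  renFm ρ (∃∈ t A)   = ∃∈ (renTm ρ t) (renFm (ext ρ) A)

  wkTm : ∀ {Γ σ τ} → Tm Γ σ → Tm (τ ∷ Γ) σ
  wkTm = renTm there

  wk : ∀ {Γ τ} → Fm Γ → Fm (τ ∷ Γ)
  wk = renFm there

  Sub : Ctx → Ctx → Set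
  Sub Γ Δ = ∀ {σ} → Γ ∋ σ → Tm Δ σ

  exts : ∀ {Γ Δ σ} → Sub Γ Δ → Sub (σ ∷ Γ) (σ ∷ Δ)
  exts s here      = var here
  exts s (there x) = wkTm (s x)

  subTm : ∀ {Γ Δ σ} → Sub Γ Δ → Tm Γ σ → Tm Δ σ
  subTm s (var x) = s x
  subTm s (con c) = con c
  subTm s (t · u) = subTm s t · subTm s u

  subFm : ∀ {Γ Δ} → Sub Γ Δ → Fm Γ → Fm Δ
  subFm s ⊥'         = ⊥'
  subFm s (t ≐ q)    = subTm s t ≐ subTm s q
  subFm s (t ∈' q)   = subTm s t ∈' subTm s q
  subFm s (rel R ts) = rel R (Vec.map (subTm s) ts)
  subFm s (A ∨' B)   = subFm s A ∨' subFm s B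
  subFm s (A ∧' B)   = subFm s A ∧' subFm s B
  subFm s (A ⊃ B)    = subFm s A ⊃ subFm s B
  subFm s (∀' σ A)   = ∀' σ (subFm (exts s) A)
  subFm s (∃' σ A)   = ∃' σ (subFm (exts s) A)
  subFm s (∀∈ t A)   = ∀∈ (subTm s t) (subFm (exts s) A)
  subFm s (∃∈ t A)   = ∃∈ (subTm s t) (subFm (exts s) A)

  single : ∀ {Γ σ} → Tm Γ σ → Sub (σ ∷ Γ) Γ
  single t here      = t
  single t (there x) = var x

  _[_] : ∀ {Γ σ} → Fm (σ ∷ Γ) → Tm Γ σ → Fm Γ
  A [ t ] = subFm (single t) A

  data Ax {Γ : Ctx} : Fm Γ → Set where
    eq-refl  : ∀ {σ} (t : Tm Γ σ) → Ax (t ≐ t)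
    eq-subst : ∀ {σ} (A : Fm (σ ∷ Γ)) → Atomic A → (t s : Tm Γ σ) →
               Ax (t ≐ s ∧' A [ t ] ⊃ A [ s ])
    ∀∈-def   : ∀ {σ} (t : Tm Γ (σ *)) (A : Fm (σ ∷ Γ)) →
               Ax (∀∈ t A ⇔ ∀' σ (var here ∈' wkTm t ⊃ A))
    ∃∈-def   : ∀ {σ} (t : Tm Γ (σ *)) (A : Fm (σ ∷ Γ)) →
               Ax (∃∈ t A ⇔ ∃' σ (var here ∈' wkTm t ∧' A))
    Σ-ax     : ∀ {ρ σ τ} (x : Tm Γ (ρ ⇒ σ ⇒ τ)) (y : Tm Γ (ρ ⇒ σ)) (z : Tm Γ ρ) →
               Ax (con (Σc ρ σ τ) · x · y · z ≐ x · z · (y · z))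
    Π-ax     : ∀ {σ τ} (x : Tm Γ σ) (y : Tm Γ τ) →
               Ax (con (Πc σ τ) · x · y ≐ x)
    sng-ax   : ∀ {σ} (w x : Tm Γ σ) →
               Ax (w ∈' con (sng σ) · x ⇔ w ≐ x)
    cup-ax   : ∀ {σ} (w : Tm Γ σ) (x y : Tm Γ (σ *)) →
               Ax (w ∈' con (cup σ) · x · y ⇔ (w ∈' x ∨' w ∈' y))
    bigcup-ax : ∀ {σ τ} (z : Tm Γ σ) (x : Tm Γ (σ *)) (w : Tm Γ τ) (y : Tm Γ (σ ⇒ τ *)) →
               Ax (z ∈' x ∧' w ∈' y · z ⊃ w ∈' con (bigcup σ τ) · x · y)
    bigcup-sng : ∀ {σ τ} (x : Tm Γ σ) (y : Tm Γ (σ ⇒ τ *)) →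
               Ax (con (bigcup σ τ) · (con (sng σ) · x) · y ≐ y · x)
    bigcup-cup : ∀ {σ τ} (x y : Tm Γ (σ *)) (z : Tm Γ (σ ⇒ τ *)) →
               Ax (con (bigcup σ τ) · (con (cup σ) · x · y) · z
                   ≐ con (cup τ) · (con (bigcup σ τ) · x · z) · (con (bigcup σ τ) · y · z))
    -- AC^ω_* :  ∀x^ρ ∃y^σ A(x,y) → ∃f^{ρ→σ*} ∀x ∃y∈fx A(x,y)
    AC       : ∀ {ρ σ} (A : Fm (σ ∷ ρ ∷ Γ)) →
               Ax (∀' ρ (∃' σ A) ⊃
                   ∃' (ρ ⇒ σ *) (∀' ρ (∃∈ (var (there here) · var here)
                                             (renFm (ext (ext there)) A))))
    -- IP^*_∄ :  (B → ∃y A(y)) → ∃w (B → ∃y∈w A(y)),  B ∃-free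
    IP       : ∀ {σ} (B : Fm Γ) → ExFree B → (A : Fm (σ ∷ Γ)) →
               Ax ((B ⊃ ∃' σ A) ⊃ ∃' (σ *) (wk B ⊃ ∃∈ (var here) (renFm (ext there) A)))

  Theory : Set₁
  Theory = Fm [] → Set

  infix 2 _∣_⊢_

  data _∣_⊢_ (T : Theory) : ∀ {Γ} → List (Fm Γ) → Fm Γ → Set where
    hyp  : ∀ {Γ} {Δ : List (Fm Γ)} {A} → A ∈ Δ → T ∣ Δ ⊢ A
    ax   : ∀ {Γ} {Δ : List (Fm Γ)} {A} → Ax A → T ∣ Δ ⊢ A
    thy  : ∀ {Γ} {Δ : List (Fm Γ)} {B} → T B → T ∣ Δ ⊢ renFm fromEmpty B
    ⊥E   : ∀ {Γ} {Δ : List (Fm Γ)} {A} → T ∣ Δ ⊢ ⊥' → T ∣ Δ ⊢ A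
    ∧I   : ∀ {Γ} {Δ : List (Fm Γ)} {A B} → T ∣ Δ ⊢ A → T ∣ Δ ⊢ B → T ∣ Δ ⊢ A ∧' B
    ∧E₁  : ∀ {Γ} {Δ : List (Fm Γ)} {A B} → T ∣ Δ ⊢ A ∧' B → T ∣ Δ ⊢ A
    ∧E₂  : ∀ {Γ} {Δ : List (Fm Γ)} {A B} → T ∣ Δ ⊢ A ∧' B → T ∣ Δ ⊢ B
    ∨I₁  : ∀ {Γ} {Δ : List (Fm Γ)} {A B} → T ∣ Δ ⊢ A → T ∣ Δ ⊢ A ∨' B
    ∨I₂  : ∀ {Γ} {Δ : List (Fm Γ)} {A B} → T ∣ Δ ⊢ B → T ∣ Δ ⊢ A ∨' B
    ∨E   : ∀ {Γ} {Δ : List (Fm Γ)} {A B C} → T ∣ Δ ⊢ A ∨' B →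
           T ∣ A ∷ Δ ⊢ C → T ∣ B ∷ Δ ⊢ C → T ∣ Δ ⊢ C
    ⊃I   : ∀ {Γ} {Δ : List (Fm Γ)} {A B} → T ∣ A ∷ Δ ⊢ B → T ∣ Δ ⊢ A ⊃ B
    ⊃E   : ∀ {Γ} {Δ : List (Fm Γ)} {A B} → T ∣ Δ ⊢ A ⊃ B → T ∣ Δ ⊢ A → T ∣ Δ ⊢ B
    ∀I   : ∀ {Γ σ} {Δ : List (Fm Γ)} {A : Fm (σ ∷ Γ)} →
           T ∣ map wk Δ ⊢ A → T ∣ Δ ⊢ ∀' σ A
    ∀E   : ∀ {Γ σ} {Δ : List (Fm Γ)} {A : Fm (σ ∷ Γ)} →
           T ∣ Δ ⊢ ∀' σ A → (t : Tm Γ σ) → T ∣ Δ ⊢ A [ t ]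
    ∃I   : ∀ {Γ σ} {Δ : List (Fm Γ)} {A : Fm (σ ∷ Γ)} (t : Tm Γ σ) →
           T ∣ Δ ⊢ A [ t ] → T ∣ Δ ⊢ ∃' σ A
    ∃E   : ∀ {Γ σ} {Δ : List (Fm Γ)} {A : Fm (σ ∷ Γ)} {C : Fm Γ} →
           T ∣ Δ ⊢ ∃' σ A → T ∣ A ∷ map wk Δ ⊢ wk C → T ∣ Δ ⊢ C

  ∀s : (Zs : Ctx) → Fm Zs → Fm []
  ∀s []       A = A
  ∀s (σ ∷ Zs) A = ∀s Zs (∀' σ A)

  ∃s : ∀ {Zs} (Ws : Ctx) → Fm (Ws ++ Zs) → Fm Zs
  ∃s []       A = A
  ∃s (σ ∷ Ws) A = ∃s Ws (∃' σ A)

  appVars : ∀ {Γ τ} (Zs : Ctx) → Ren Zs Γ → Tm Γ (Zs ⇛ τ) → Tm Γ τ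
  appVars []       ρ t = t
  appVars (σ ∷ Zs) ρ t = appVars Zs (λ x → ρ (there x)) t · var (ρ here)

  ∃∈s : ∀ {Zs} (Ws : Ctx) → All (λ τ → Tm [] (Zs ⇛ τ *)) Ws → Fm (Ws ++ Zs) → Fm Zs
  ∃∈s []       []       A = A
  ∃∈s {Zs} (σ ∷ Ws) (r ∷ rs) A =
    ∃∈s Ws rs (∃∈ (appVars Zs (wkBy Ws) (renTm fromEmpty r)) A)

{-# OPTIONS --safe #-}
-- Bounded modified realizability with truth is sound for the theory.  An
-- existential is realized by a finite set of candidate witnesses, and a
-- realizer of an implication must also make it true, so ∃-free formulas
-- (the axioms of T and the premise of IP) are realized by anything, and AC
-- is realized by a singleton since a realizer of ∀x∃y A already is a
-- set-valued choice function.  Realizers can be enlarged along extensional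
-- inclusion, which lets ∨E and ∃E merge the candidate realizers of their
-- branches by binary and indexed unions.  By induction on derivations,
-- every provable formula has a realizer that is a term of the system,
-- provably so.  For a closed proof of ∀z⃗∃w⃗ A the realizer is a tuple of
-- closed terms whose first components, applied to z⃗, bound w⃗; truth of the
-- realizability formula then gives ∀z⃗ ∃w⃗ ∈ r⃗ z⃗ A.
module Submission where

open import Defs
open import Data.List using (List; []; _∷_; _++_; map)
open import Data.List.Relation.Unary.All using (All; []; _∷_)
import Data.List.Relation.Unary.All as All
import Data.List.Relation.Unary.All.Properties as Allₚ
open import Data.Product using (Σ; _,_; proj₁; proj₂; _×_)
import Data.Vec as Vec
import Data.Vec.Properties as Vecₚ
import Data.List.Properties as Listₚ
open import Data.List.Relation.Unary.Any using (here; there)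
open import Data.List.Membership.Propositional using (_∈_)
open import Data.List.Membership.Propositional.Properties using (∈-map⁺; ∈-map⁻)
open import Data.List.Relation.Binary.Subset.Propositional using (_⊆_)
import Data.List.Relation.Binary.Subset.Propositional.Properties as ⊆ₚ
open import Function using (_∘_; id)
open import Relation.Binary.PropositionalEquality hiding ([_])

module _ {A : Set} {P Q : A → Set} where

  ++⁻ˡ-map : (xs : List A) {ys : List A} (f : ∀ {x} → P x → Q x) (ps : All P (xs ++ ys)) →
             Allₚ.++⁻ˡ xs (All.map f ps) ≡ All.map f (Allₚ.++⁻ˡ xs ps)
  ++⁻ˡ-map []       f ps       = refl
  ++⁻ˡ-map (x ∷ xs) f (p ∷ ps) = cong (f p ∷_) (++⁻ˡ-map xs f ps)

  ++⁻ʳ-map : (xs : List A) {ys : List A} (f : ∀ {x} → P x → Q x) (ps : All P (xs ++ ys)) →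
             Allₚ.++⁻ʳ xs (All.map f ps) ≡ All.map f (Allₚ.++⁻ʳ xs ps)
  ++⁻ʳ-map []       f ps       = refl
  ++⁻ʳ-map (x ∷ xs) f (p ∷ ps) = ++⁻ʳ-map xs f ps

module _ {A : Set} {P : A → Set} where

  ++⁻ˡ∘++⁺ : {xs ys : List A} (ps : All P xs) (qs : All P ys) → Allₚ.++⁻ˡ xs (Allₚ.++⁺ ps qs) ≡ ps
  ++⁻ˡ∘++⁺ []       qs = refl
  ++⁻ˡ∘++⁺ (p ∷ ps) qs = cong (p ∷_) (++⁻ˡ∘++⁺ ps qs)

  ++⁻ʳ∘++⁺ : {xs ys : List A} (ps : All P xs) (qs : All P ys) → Allₚ.++⁻ʳ xs (Allₚ.++⁺ ps qs) ≡ qs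
  ++⁻ʳ∘++⁺ []       qs = refl
  ++⁻ʳ∘++⁺ (p ∷ ps) qs = ++⁻ʳ∘++⁺ ps qs

module Substitution (L : Language) where
  open Syn L

  private variable
    Γ Γ' Δ Δ' Θ Θ' : Ctx
    σ τ : Ty
    Xs Ys : List Ty

  infix 4 _≗ˢ_
  infixl 5 _⨾_

  _≗ˢ_ : Sub Γ Δ → Sub Γ Δ → Set
  s ≗ˢ s' = ∀ {σ} (x : _ ∋ σ) → s x ≡ s' x

  toSub : Ren Γ Δ → Sub Γ Δ
  toSub ρ x = var (ρ x)

  _⨾_ : Sub Γ Δ → Sub Δ Θ → Sub Γ Θ
  (s ⨾ s') x = subTm s' (s x)

  exts-cong : {s s' : Sub Γ Δ} → s ≗ˢ s' → exts {σ = σ} s ≗ˢ exts s'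
  exts-cong e here      = refl
  exts-cong e (there x) = cong wkTm (e x)

  exts-toSub : (ρ : Ren Γ Δ) → exts {σ = σ} (toSub ρ) ≗ˢ toSub (ext ρ)
  exts-toSub ρ here      = refl
  exts-toSub ρ (there x) = refl

  exts-var : exts {Γ = Γ} {σ = σ} var ≗ˢ var
  exts-var here      = refl
  exts-var (there x) = refl

  subTm-cong : {s s' : Sub Γ Δ} → s ≗ˢ s' → (t : Tm Γ σ) → subTm s t ≡ subTm s' t
  subTm-cong e (var x) = e x
  subTm-cong e (con c) = refl
  subTm-cong e (t · u) = cong₂ _·_ (subTm-cong e t) (subTm-cong e u)

  renTm≡subTm : (ρ : Ren Γ Δ) (t : Tm Γ σ) → renTm ρ t ≡ subTm (toSub ρ) t
  renTm≡subTm ρ (var x) = refl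
  renTm≡subTm ρ (con c) = refl
  renTm≡subTm ρ (t · u) = cong₂ _·_ (renTm≡subTm ρ t) (renTm≡subTm ρ u)

  subTm-∘ : (s : Sub Γ Δ) (s' : Sub Δ Θ) (t : Tm Γ σ) →
            subTm s' (subTm s t) ≡ subTm (s ⨾ s') t
  subTm-∘ s s' (var x) = refl
  subTm-∘ s s' (con c) = refl
  subTm-∘ s s' (t · u) = cong₂ _·_ (subTm-∘ s s' t) (subTm-∘ s s' u)

  subTm-id : (t : Tm Γ σ) → subTm var t ≡ t
  subTm-id (var x) = refl
  subTm-id (con c) = refl
  subTm-id (t · u) = cong₂ _·_ (subTm-id t) (subTm-id u)

  subTm-renTm : (ρ : Ren Γ Δ) (s : Sub Δ Θ) (t : Tm Γ σ) →
                subTm s (renTm ρ t) ≡ subTm (s ∘ ρ) t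
  subTm-renTm ρ s t = trans (cong (subTm s) (renTm≡subTm ρ t)) (subTm-∘ (toSub ρ) s t)

  renTm-subTm : (s : Sub Γ Δ) (ρ : Ren Δ Θ) (t : Tm Γ σ) →
                renTm ρ (subTm s t) ≡ subTm (renTm ρ ∘ s) t
  renTm-subTm s ρ t = begin
    renTm ρ (subTm s t)         ≡⟨ renTm≡subTm ρ (subTm s t) ⟩
    subTm (toSub ρ) (subTm s t) ≡⟨ subTm-∘ s (toSub ρ) t ⟩
    subTm (s ⨾ toSub ρ) t       ≡⟨ subTm-cong (λ x → sym (renTm≡subTm ρ (s x))) t ⟩
    subTm (renTm ρ ∘ s) t       ∎
    where open ≡-Reasoning

  renTm-∘ : (ρ : Ren Γ Δ) (ρ' : Ren Δ Θ) (t : Tm Γ σ) →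
            renTm ρ' (renTm ρ t) ≡ renTm (ρ' ∘ ρ) t
  renTm-∘ ρ ρ' t = begin
    renTm ρ' (renTm ρ t)        ≡⟨ renTm≡subTm ρ' (renTm ρ t) ⟩
    subTm (toSub ρ') (renTm ρ t) ≡⟨ subTm-renTm ρ (toSub ρ') t ⟩
    subTm (toSub (ρ' ∘ ρ)) t    ≡⟨ sym (renTm≡subTm (ρ' ∘ ρ) t) ⟩
    renTm (ρ' ∘ ρ) t            ∎
    where open ≡-Reasoning

  renTm-id : (t : Tm Γ σ) → renTm (λ x → x) t ≡ t
  renTm-id t = trans (renTm≡subTm (λ x → x) t) (subTm-id t)

  wkTm-renTm : (ρ : Ren Γ Δ) (t : Tm Γ τ) →
               renTm (ext {σ = σ} ρ) (wkTm t) ≡ wkTm (renTm ρ t)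
  wkTm-renTm ρ t = trans (renTm-∘ there (ext ρ) t) (sym (renTm-∘ ρ there t))

  wkTm-subTm : (s : Sub Γ Δ) (t : Tm Γ σ) →
               subTm (exts {σ = τ} s) (wkTm t) ≡ wkTm (subTm s t)
  wkTm-subTm s t = trans (subTm-renTm there (exts s) t) (sym (renTm-subTm s there t))

  single-wkTm : (u : Tm Γ σ) (t : Tm Γ τ) → subTm (single u) (wkTm t) ≡ t
  single-wkTm u t = trans (subTm-renTm there (single u) t) (subTm-id t)

  exts-⨾ : (s : Sub Γ Δ) (s' : Sub Δ Θ) → exts {σ = σ} s ⨾ exts s' ≗ˢ exts (s ⨾ s')
  exts-⨾ s s' here      = refl
  exts-⨾ s s' (there x) = wkTm-subTm s' (s x)

  subFm-cong : {s s' : Sub Γ Δ} → s ≗ˢ s' → (A : Fm Γ) → subFm s A ≡ subFm s' A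
  subFm-cong e ⊥'         = refl
  subFm-cong e (t ≐ q)    = cong₂ _≐_ (subTm-cong e t) (subTm-cong e q)
  subFm-cong e (t ∈' q)   = cong₂ _∈'_ (subTm-cong e t) (subTm-cong e q)
  subFm-cong e (rel R ts) = cong (rel R) (Vecₚ.map-cong (subTm-cong e) ts)
  subFm-cong e (A ∨' B)   = cong₂ _∨'_ (subFm-cong e A) (subFm-cong e B)
  subFm-cong e (A ∧' B)   = cong₂ _∧'_ (subFm-cong e A) (subFm-cong e B)
  subFm-cong e (A ⊃ B)    = cong₂ _⊃_ (subFm-cong e A) (subFm-cong e B)
  subFm-cong e (∀' σ A)   = cong (∀' σ) (subFm-cong (exts-cong e) A)
  subFm-cong e (∃' σ A)   = cong (∃' σ) (subFm-cong (exts-cong e) A)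
  subFm-cong e (∀∈ t A)   = cong₂ ∀∈ (subTm-cong e t) (subFm-cong (exts-cong e) A)
  subFm-cong e (∃∈ t A)   = cong₂ ∃∈ (subTm-cong e t) (subFm-cong (exts-cong e) A)

  renFm≡subFm-ext : (ρ : Ren Γ Δ) (A : Fm (σ ∷ Γ)) →
                    renFm (ext ρ) A ≡ subFm (exts (toSub ρ)) A

  renFm≡subFm : (ρ : Ren Γ Δ) (A : Fm Γ) → renFm ρ A ≡ subFm (toSub ρ) A
  renFm≡subFm ρ ⊥'         = refl
  renFm≡subFm ρ (t ≐ q)    = cong₂ _≐_ (renTm≡subTm ρ t) (renTm≡subTm ρ q)
  renFm≡subFm ρ (t ∈' q)   = cong₂ _∈'_ (renTm≡subTm ρ t) (renTm≡subTm ρ q)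
  renFm≡subFm ρ (rel R ts) = cong (rel R) (Vecₚ.map-cong (renTm≡subTm ρ) ts)
  renFm≡subFm ρ (A ∨' B)   = cong₂ _∨'_ (renFm≡subFm ρ A) (renFm≡subFm ρ B)
  renFm≡subFm ρ (A ∧' B)   = cong₂ _∧'_ (renFm≡subFm ρ A) (renFm≡subFm ρ B)
  renFm≡subFm ρ (A ⊃ B)    = cong₂ _⊃_ (renFm≡subFm ρ A) (renFm≡subFm ρ B)
  renFm≡subFm ρ (∀' σ A)   = cong (∀' σ) (renFm≡subFm-ext ρ A)
  renFm≡subFm ρ (∃' σ A)   = cong (∃' σ) (renFm≡subFm-ext ρ A)
  renFm≡subFm ρ (∀∈ t A)   = cong₂ ∀∈ (renTm≡subTm ρ t) (renFm≡subFm-ext ρ A)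
  renFm≡subFm ρ (∃∈ t A)   = cong₂ ∃∈ (renTm≡subTm ρ t) (renFm≡subFm-ext ρ A)

  renFm≡subFm-ext ρ A = trans (renFm≡subFm (ext ρ) A) (sym (subFm-cong (exts-toSub ρ) A))

  subFm-∘-exts : (s : Sub Γ Δ) (s' : Sub Δ Θ) (A : Fm (σ ∷ Γ)) →
                 subFm (exts s') (subFm (exts s) A) ≡ subFm (exts (s ⨾ s')) A

  subFm-∘ : (s : Sub Γ Δ) (s' : Sub Δ Θ) (A : Fm Γ) →
            subFm s' (subFm s A) ≡ subFm (s ⨾ s') A
  subFm-∘ s s' ⊥'         = refl
  subFm-∘ s s' (t ≐ q)    = cong₂ _≐_ (subTm-∘ s s' t) (subTm-∘ s s' q)
  subFm-∘ s s' (t ∈' q)   = cong₂ _∈'_ (subTm-∘ s s' t) (subTm-∘ s s' q)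
  subFm-∘ s s' (rel R ts) =
    cong (rel R) (trans (sym (Vecₚ.map-∘ (subTm s') (subTm s) ts)) (Vecₚ.map-cong (subTm-∘ s s') ts))
  subFm-∘ s s' (A ∨' B)   = cong₂ _∨'_ (subFm-∘ s s' A) (subFm-∘ s s' B)
  subFm-∘ s s' (A ∧' B)   = cong₂ _∧'_ (subFm-∘ s s' A) (subFm-∘ s s' B)
  subFm-∘ s s' (A ⊃ B)    = cong₂ _⊃_ (subFm-∘ s s' A) (subFm-∘ s s' B)
  subFm-∘ s s' (∀' σ A)   = cong (∀' σ) (subFm-∘-exts s s' A)
  subFm-∘ s s' (∃' σ A)   = cong (∃' σ) (subFm-∘-exts s s' A)
  subFm-∘ s s' (∀∈ t A)   = cong₂ ∀∈ (subTm-∘ s s' t) (subFm-∘-exts s s' A)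
  subFm-∘ s s' (∃∈ t A)   = cong₂ ∃∈ (subTm-∘ s s' t) (subFm-∘-exts s s' A)

  subFm-∘-exts s s' A = trans (subFm-∘ (exts s) (exts s') A) (subFm-cong (exts-⨾ s s') A)

  subFm-id-exts : (A : Fm (σ ∷ Γ)) → subFm (exts var) A ≡ A

  subFm-id : (A : Fm Γ) → subFm var A ≡ A
  subFm-id ⊥'         = refl
  subFm-id (t ≐ q)    = cong₂ _≐_ (subTm-id t) (subTm-id q)
  subFm-id (t ∈' q)   = cong₂ _∈'_ (subTm-id t) (subTm-id q)
  subFm-id (rel R ts) = cong (rel R) (trans (Vecₚ.map-cong subTm-id ts) (Vecₚ.map-id ts))
  subFm-id (A ∨' B)   = cong₂ _∨'_ (subFm-id A) (subFm-id B)
  subFm-id (A ∧' B)   = cong₂ _∧'_ (subFm-id A) (subFm-id B)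
  subFm-id (A ⊃ B)    = cong₂ _⊃_ (subFm-id A) (subFm-id B)
  subFm-id (∀' σ A)   = cong (∀' σ) (subFm-id-exts A)
  subFm-id (∃' σ A)   = cong (∃' σ) (subFm-id-exts A)
  subFm-id (∀∈ t A)   = cong₂ ∀∈ (subTm-id t) (subFm-id-exts A)
  subFm-id (∃∈ t A)   = cong₂ ∃∈ (subTm-id t) (subFm-id-exts A)

  subFm-id-exts A = trans (subFm-cong exts-var A) (subFm-id A)

  subFm-renFm : (ρ : Ren Γ Δ) (s : Sub Δ Θ) (A : Fm Γ) →
                subFm s (renFm ρ A) ≡ subFm (s ∘ ρ) A
  subFm-renFm ρ s A = trans (cong (subFm s) (renFm≡subFm ρ A)) (subFm-∘ (toSub ρ) s A)

  renFm-subFm : (s : Sub Γ Δ) (ρ : Ren Δ Θ) (A : Fm Γ) →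
                renFm ρ (subFm s A) ≡ subFm (renTm ρ ∘ s) A
  renFm-subFm s ρ A = begin
    renFm ρ (subFm s A)         ≡⟨ renFm≡subFm ρ (subFm s A) ⟩
    subFm (toSub ρ) (subFm s A) ≡⟨ subFm-∘ s (toSub ρ) A ⟩
    subFm (s ⨾ toSub ρ) A       ≡⟨ subFm-cong (λ x → sym (renTm≡subTm ρ (s x))) A ⟩
    subFm (renTm ρ ∘ s) A       ∎
    where open ≡-Reasoning

  renFm-∘ : (ρ : Ren Γ Δ) (ρ' : Ren Δ Θ) (A : Fm Γ) →
            renFm ρ' (renFm ρ A) ≡ renFm (ρ' ∘ ρ) A
  renFm-∘ ρ ρ' A = begin
    renFm ρ' (renFm ρ A)         ≡⟨ renFm≡subFm ρ' (renFm ρ A) ⟩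
    subFm (toSub ρ') (renFm ρ A) ≡⟨ subFm-renFm ρ (toSub ρ') A ⟩
    subFm (toSub (ρ' ∘ ρ)) A     ≡⟨ sym (renFm≡subFm (ρ' ∘ ρ) A) ⟩
    renFm (ρ' ∘ ρ) A             ∎
    where open ≡-Reasoning

  subFm-renFm-comm : {ρ : Ren Γ Δ} {s' : Sub Δ Δ'} {s : Sub Γ Γ'} {ρ' : Ren Γ' Δ'} →
                     s' ∘ ρ ≗ˢ renTm ρ' ∘ s →
                     (A : Fm Γ) → subFm s' (renFm ρ A) ≡ renFm ρ' (subFm s A)
  subFm-renFm-comm {ρ = ρ} {s'} {s} {ρ'} e A =
    trans (subFm-renFm ρ s' A) (trans (subFm-cong e A) (sym (renFm-subFm s ρ' A)))

  exts-comm : {ρ : Ren Γ Δ} {s' : Sub Δ Δ'} {s : Sub Γ Γ'} {ρ' : Ren Γ' Δ'} →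
                s' ∘ ρ ≗ˢ renTm ρ' ∘ s → exts {σ = σ} s' ∘ ext ρ ≗ˢ renTm (ext ρ') ∘ exts s
  exts-comm e here                          = refl
  exts-comm {s = s} {ρ'} e (there x) =
    trans (cong wkTm (e x)) (trans (renTm-∘ ρ' there (s x)) (sym (renTm-∘ there (ext ρ') (s x))))

  wk-subFm : (s : Sub Γ Δ) (A : Fm Γ) → subFm (exts {σ = σ} s) (wk A) ≡ wk (subFm s A)
  wk-subFm s = subFm-renFm-comm (λ x → refl)

  subFm-[] : (s : Sub Γ Δ) (t : Tm Γ σ) (A : Fm (σ ∷ Γ)) →
             subFm s (A [ t ]) ≡ subFm (exts s) A [ subTm s t ]
  subFm-[] s t A = trans (subFm-∘ (single t) s A) (trans (subFm-cong pointwise A) (sym (subFm-∘ (exts s) _ A)))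
    where
    pointwise : single t ⨾ s ≗ˢ exts s ⨾ single (subTm s t)
    pointwise here      = refl
    pointwise (there x) = sym (single-wkTm (subTm s t) (s x))

  ext-there-[here] : (A : Fm (σ ∷ Γ)) → renFm (ext there) A [ var here ] ≡ A
  ext-there-[here] A =
    trans (subFm-renFm (ext there) (single (var here)) A) (trans (subFm-cong pointwise A) (subFm-id A))
    where
    pointwise : single (var here) ∘ ext there ≗ˢ var
    pointwise here      = refl
    pointwise (there x) = refl

  closed : Tm [] τ → Tm Γ τ
  closed = renTm fromEmpty

  subTm-closed : (s : Sub Γ Θ) (c : Tm [] τ) → subTm s (closed c) ≡ closed c
  subTm-closed s c =
    trans (subTm-renTm fromEmpty s c) (trans (subTm-cong (λ ()) c) (sym (renTm≡subTm fromEmpty c)))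

  renTm-closed : (ρ : Ren Γ Θ) (c : Tm [] τ) → renTm ρ (closed c) ≡ closed c
  renTm-closed ρ c = trans (renTm≡subTm ρ (closed c)) (subTm-closed (toSub ρ) c)

  closed-id : (c : Tm [] τ) → closed c ≡ c
  closed-id c = trans (renTm≡subTm fromEmpty c) (trans (subTm-cong (λ ()) c) (subTm-id c))

  subFm-closed : (s : Sub Γ Θ) (B : Fm []) → subFm s (renFm fromEmpty B) ≡ renFm fromEmpty B
  subFm-closed s B = trans (subFm-renFm-comm {s = var} (λ ()) B) (cong (renFm fromEmpty) (subFm-id B))

  ExFree-subFm : (s : Sub Γ Δ) {A : Fm Γ} → ExFree A → ExFree (subFm s A)
  ExFree-subFm s ef-⊥          = ef-⊥
  ExFree-subFm s (ef-≐ t q)    = ef-≐ _ _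
  ExFree-subFm s (ef-∈ t q)    = ef-∈ _ _
  ExFree-subFm s (ef-rel R ts) = ef-rel R _
  ExFree-subFm s (ef-∨ a b)    = ef-∨ (ExFree-subFm s a) (ExFree-subFm s b)
  ExFree-subFm s (ef-∧ a b)    = ef-∧ (ExFree-subFm s a) (ExFree-subFm s b)
  ExFree-subFm s (ef-⊃ a b)    = ef-⊃ (ExFree-subFm s a) (ExFree-subFm s b)
  ExFree-subFm s (ef-∀ a)      = ef-∀ (ExFree-subFm (exts s) a)
  ExFree-subFm s (ef-∀∈ a)     = ef-∀∈ (ExFree-subFm (exts s) a)
  ExFree-subFm s (ef-∃∈ a)     = ef-∃∈ (ExFree-subFm (exts s) a)

  Atomic-subFm : (s : Sub Γ Δ) {A : Fm Γ} → Atomic A → Atomic (subFm s A)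
  Atomic-subFm s at-⊥          = at-⊥
  Atomic-subFm s (at-≐ t q)    = at-≐ _ _
  Atomic-subFm s (at-∈ t q)    = at-∈ _ _
  Atomic-subFm s (at-rel R ts) = at-rel R _

  Atomic⇒ExFree : {A : Fm Γ} → Atomic A → ExFree A
  Atomic⇒ExFree at-⊥          = ef-⊥
  Atomic⇒ExFree (at-≐ t q)    = ef-≐ t q
  Atomic⇒ExFree (at-∈ t q)    = ef-∈ t q
  Atomic⇒ExFree (at-rel R ts) = ef-rel R ts

  ExFree-renFm : (ρ : Ren Γ Θ) {A : Fm Γ} → ExFree A → ExFree (renFm ρ A)
  ExFree-renFm ρ {A} ef = subst ExFree (sym (renFm≡subFm ρ A)) (ExFree-subFm (toSub ρ) ef)

  Ax-subFm : (s : Sub Γ Δ) {A : Fm Γ} → Ax A → Ax (subFm s A)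
  Ax-subFm s (eq-refl t)          = eq-refl _
  Ax-subFm s (eq-subst A at t u)  =
    subst₂ (λ X Y → Ax (subTm s t ≐ subTm s u ∧' X ⊃ Y)) (sym (subFm-[] s t A)) (sym (subFm-[] s u A))
      (eq-subst (subFm (exts s) A) (Atomic-subFm (exts s) at) (subTm s t) (subTm s u))
  Ax-subFm s (∀∈-def t A)         =
    subst (λ X → Ax (∀∈ (subTm s t) (subFm (exts s) A) ⇔ ∀' _ (var here ∈' X ⊃ subFm (exts s) A)))
      (sym (wkTm-subTm s t)) (∀∈-def (subTm s t) (subFm (exts s) A))
  Ax-subFm s (∃∈-def t A)         =
    subst (λ X → Ax (∃∈ (subTm s t) (subFm (exts s) A) ⇔ ∃' _ (var here ∈' X ∧' subFm (exts s) A)))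
      (sym (wkTm-subTm s t)) (∃∈-def (subTm s t) (subFm (exts s) A))
  Ax-subFm s (Σ-ax x y z)         = Σ-ax _ _ _
  Ax-subFm s (Π-ax x y)           = Π-ax _ _
  Ax-subFm s (sng-ax w x)         = sng-ax _ _
  Ax-subFm s (cup-ax w x y)       = cup-ax _ _ _
  Ax-subFm s (bigcup-ax z x w y)  = bigcup-ax _ _ _ _
  Ax-subFm s (bigcup-sng x y)     = bigcup-sng _ _
  Ax-subFm s (bigcup-cup x y z)   = bigcup-cup _ _ _
  Ax-subFm s (AC {ρ} {σ} A)       =
    subst (λ X → Ax (∀' ρ (∃' σ (subFm (exts (exts s)) A)) ⊃
                     ∃' (ρ ⇒ σ *) (∀' ρ (∃∈ (var (there here) · var here) X))))
      (sym (subFm-renFm-comm (exts-comm (exts-comm (λ x → refl))) A))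
      (AC (subFm (exts (exts s)) A))
  Ax-subFm s (IP {σ} B ef A)      =
    subst₂ (λ X Y → Ax ((subFm s B ⊃ ∃' σ (subFm (exts s) A)) ⊃
                        ∃' (σ *) (X ⊃ ∃∈ (var here) Y)))
      (sym (wk-subFm s B)) (sym (subFm-renFm-comm (exts-comm (λ x → refl)) A))
      (IP (subFm s B) (ExFree-subFm s ef) (subFm (exts s) A))

  Tms : Ctx → List Ty → Set
  Tms Θ = All (Tm Θ)

  _⊕_ : Tms Θ Xs → Sub Γ Θ → Sub (Xs ++ Γ) Θ
  ([] ⊕ s) x               = s x
  ((a ∷ as) ⊕ s) here      = a
  ((a ∷ as) ⊕ s) (there x) = (as ⊕ s) x

  vars : (Xs : Ctx) → Tms (Xs ++ Θ) Xs
  vars []       = []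
  vars (σ ∷ Xs) = var here ∷ All.map wkTm (vars Xs)

  wkSubBy : (Xs : Ctx) → Sub Γ Θ → Sub Γ (Xs ++ Θ)
  wkSubBy Xs s = renTm (wkBy Xs) ∘ s

  extsBy : (Xs : Ctx) → Sub Γ Δ → Sub (Xs ++ Γ) (Xs ++ Δ)
  extsBy []       s = s
  extsBy (σ ∷ Xs) s = exts (extsBy Xs s)

  Alls : (Xs : Ctx) → Fm (Xs ++ Θ) → Fm Θ
  Alls []       B = B
  Alls (σ ∷ Xs) B = Alls Xs (∀' σ B)

  Alls-subFm : (Xs : Ctx) (s : Sub Γ Δ) (B : Fm (Xs ++ Γ)) →
               subFm s (Alls Xs B) ≡ Alls Xs (subFm (extsBy Xs s) B)
  Alls-subFm []       s B = refl
  Alls-subFm (σ ∷ Xs) s B = Alls-subFm Xs s (∀' σ B)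

  ⊕-wkBy : (as : Tms Θ Xs) (s : Sub Γ Θ) → (as ⊕ s) ∘ wkBy Xs ≗ˢ s
  ⊕-wkBy []       s y = refl
  ⊕-wkBy (a ∷ as) s y = ⊕-wkBy as s y

  extsBy-wkBy : (Xs : Ctx) (s : Sub Γ Δ) → extsBy Xs s ∘ wkBy Xs ≗ˢ renTm (wkBy Xs) ∘ s
  extsBy-wkBy []       s y = sym (renTm-id (s y))
  extsBy-wkBy (σ ∷ Xs) s y = trans (cong wkTm (extsBy-wkBy Xs s y)) (renTm-∘ (wkBy Xs) there (s y))

  subTm-extsBy-wkBy : (Xs : Ctx) (s : Sub Γ Δ) (t : Tm Γ τ) →
                      subTm (extsBy Xs s) (renTm (wkBy Xs) t) ≡ renTm (wkBy Xs) (subTm s t)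
  subTm-extsBy-wkBy Xs s t =
    trans (subTm-renTm (wkBy Xs) (extsBy Xs s) t)
          (trans (subTm-cong (extsBy-wkBy Xs s) t) (sym (renTm-subTm s (wkBy Xs) t)))

  extsBy-vars : (Xs : Ctx) (s : Sub Γ Δ) → All.map (subTm (extsBy Xs s)) (vars Xs) ≡ vars Xs
  extsBy-vars []       s = refl
  extsBy-vars (σ ∷ Xs) s = cong (var here ∷_) (begin
    All.map (subTm (exts (extsBy Xs s))) (All.map wkTm (vars Xs))
      ≡⟨ Allₚ.map-∘ (vars Xs) ⟩
    All.map (subTm (exts (extsBy Xs s)) ∘ wkTm) (vars Xs)
      ≡⟨ Allₚ.map-cong (vars Xs) (wkTm-subTm (extsBy Xs s)) ⟩
    All.map (wkTm ∘ subTm (extsBy Xs s)) (vars Xs)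
      ≡⟨ sym (Allₚ.map-∘ (vars Xs)) ⟩
    All.map wkTm (All.map (subTm (extsBy Xs s)) (vars Xs))
      ≡⟨ cong (All.map wkTm) (extsBy-vars Xs s) ⟩
    All.map wkTm (vars Xs) ∎)
    where open ≡-Reasoning

  ⊕-renTm : (ρ : Ren Θ Θ') (as : Tms Θ Xs) (s : Sub Γ Θ) →
            All.map (renTm ρ) as ⊕ (renTm ρ ∘ s) ≗ˢ renTm ρ ∘ (as ⊕ s)
  ⊕-renTm ρ []       s x         = refl
  ⊕-renTm ρ (a ∷ as) s here      = refl
  ⊕-renTm ρ (a ∷ as) s (there x) = ⊕-renTm ρ as s x

  ⊕-vars : (as : Tms Θ Xs) (s : Sub Γ Θ) → All.map (subTm (as ⊕ s)) (vars Xs) ≡ as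
  ⊕-vars []       s = refl
  ⊕-vars (a ∷ as) s = cong (a ∷_) (begin
    All.map (subTm ((a ∷ as) ⊕ s)) (All.map wkTm (vars _))
      ≡⟨ Allₚ.map-∘ (vars _) ⟩
    All.map (subTm ((a ∷ as) ⊕ s) ∘ wkTm) (vars _)
      ≡⟨ Allₚ.map-cong (vars _) (subTm-renTm there _) ⟩
    All.map (subTm (as ⊕ s)) (vars _)
      ≡⟨ ⊕-vars as s ⟩
    as ∎)
    where open ≡-Reasoning

  map-wkTm-subTm : (s : Sub Γ Θ) (as : Tms Γ Xs) →
                   All.map (subTm (exts {σ = σ} s)) (All.map wkTm as) ≡ All.map wkTm (All.map (subTm s) as)
  map-wkTm-subTm s as =
    trans (Allₚ.map-∘ as) (trans (Allₚ.map-cong as (wkTm-subTm s)) (sym (Allₚ.map-∘ as)))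

  map-single-wkTm : (u : Tm Γ σ) (as : Tms Γ Xs) → All.map (subTm (single u)) (All.map wkTm as) ≡ as
  map-single-wkTm u as =
    trans (Allₚ.map-∘ as) (trans (Allₚ.map-cong as (single-wkTm u)) (Allₚ.map-id as))

  wkTmsBy : (Xs : Ctx) → Tms Θ Ys → Tms (Xs ++ Θ) Ys
  wkTmsBy Xs = All.map (renTm (wkBy Xs))

  wkTmsBy-subTm : (Xs : Ctx) (s : Sub Γ Θ) (as : Tms Γ Ys) →
                  All.map (subTm (extsBy Xs s)) (wkTmsBy Xs as) ≡ wkTmsBy Xs (All.map (subTm s) as)
  wkTmsBy-subTm Xs s as =
    trans (Allₚ.map-∘ as) (trans (Allₚ.map-cong as (subTm-extsBy-wkBy Xs s)) (sym (Allₚ.map-∘ as)))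

module DerivedRules (L : Language) (T : Syn.Theory L) where
  open Syn L
  open Substitution L

  private variable
    Γ Θ : Ctx
    σ τ : Ty
    Δ Δ' : List (Fm Γ)
    A A' B B' C : Fm Γ
    X Y : Fm (σ ∷ Γ)

  infix 2 _⊢_ _⟹_

  _⊢_ : List (Fm Γ) → Fm Γ → Set
  Δ ⊢ A = T ∣ Δ ⊢ A

  weaken : Δ ⊆ Δ' → Δ ⊢ A → Δ' ⊢ A
  weaken f (hyp p)    = hyp (f p)
  weaken f (ax a)     = ax a
  weaken f (thy b)    = thy b
  weaken f (⊥E d)     = ⊥E (weaken f d)
  weaken f (∧I d e)   = ∧I (weaken f d) (weaken f e)
  weaken f (∧E₁ d)    = ∧E₁ (weaken f d)
  weaken f (∧E₂ d)    = ∧E₂ (weaken f d)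
  weaken f (∨I₁ d)    = ∨I₁ (weaken f d)
  weaken f (∨I₂ d)    = ∨I₂ (weaken f d)
  weaken f (∨E d e g) = ∨E (weaken f d) (weaken (⊆ₚ.∷⁺ʳ _ f) e) (weaken (⊆ₚ.∷⁺ʳ _ f) g)
  weaken f (⊃I d)     = ⊃I (weaken (⊆ₚ.∷⁺ʳ _ f) d)
  weaken f (⊃E d e)   = ⊃E (weaken f d) (weaken f e)
  weaken f (∀I d)     = ∀I (weaken (⊆ₚ.map⁺ wk f) d)
  weaken f (∀E d t)   = ∀E (weaken f d) t
  weaken f (∃I t d)   = ∃I t (weaken f d)
  weaken f (∃E d e)   = ∃E (weaken f d) (weaken (⊆ₚ.∷⁺ʳ _ (⊆ₚ.map⁺ wk f)) e)

  wkHyp : Δ ⊢ A → B ∷ Δ ⊢ A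
  wkHyp = weaken there

  map-subFm-wk : (s : Sub Γ Θ) (Φ : List (Fm Γ)) →
                 map (subFm (exts {σ = σ} s)) (map wk Φ) ≡ map wk (map (subFm s) Φ)
  map-subFm-wk s Φ =
    trans (sym (Listₚ.map-∘ Φ)) (trans (Listₚ.map-cong (wk-subFm s) Φ) (Listₚ.map-∘ Φ))

  ⊢-subFm : Δ ⊢ A → (s : Sub Γ Θ) → map (subFm s) Δ ⊢ subFm s A
  ⊢-subFm (hyp p)    s = hyp (∈-map⁺ (subFm s) p)
  ⊢-subFm (ax a)     s = ax (Ax-subFm s a)
  ⊢-subFm (thy {B = B} b) s = subst (_ ⊢_) (sym (subFm-closed s B)) (thy b)
  ⊢-subFm (⊥E d)     s = ⊥E (⊢-subFm d s)
  ⊢-subFm (∧I d e)   s = ∧I (⊢-subFm d s) (⊢-subFm e s)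
  ⊢-subFm (∧E₁ d)    s = ∧E₁ (⊢-subFm d s)
  ⊢-subFm (∧E₂ d)    s = ∧E₂ (⊢-subFm d s)
  ⊢-subFm (∨I₁ d)    s = ∨I₁ (⊢-subFm d s)
  ⊢-subFm (∨I₂ d)    s = ∨I₂ (⊢-subFm d s)
  ⊢-subFm (∨E d e g) s = ∨E (⊢-subFm d s) (⊢-subFm e s) (⊢-subFm g s)
  ⊢-subFm (⊃I d)     s = ⊃I (⊢-subFm d s)
  ⊢-subFm (⊃E d e)   s = ⊃E (⊢-subFm d s) (⊢-subFm e s)
  ⊢-subFm {Δ = Δ} (∀I d) s = ∀I (subst (_⊢ _) (map-subFm-wk s Δ) (⊢-subFm d (exts s)))
  ⊢-subFm (∀E {A = A} d t) s = subst (_ ⊢_) (sym (subFm-[] s t A)) (∀E (⊢-subFm d s) (subTm s t))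
  ⊢-subFm (∃I {A = A} t d) s = ∃I (subTm s t) (subst (_ ⊢_) (subFm-[] s t A) (⊢-subFm d s))
  ⊢-subFm {Δ = Δ} (∃E {C = C} d e) s =
    ∃E (⊢-subFm d s)
       (subst₂ (λ Φ X → _ ∷ Φ ⊢ X) (map-subFm-wk s Δ) (wk-subFm s C) (⊢-subFm e (exts s)))

  ⊢-renFm : (ρ : Ren Γ Θ) → Δ ⊢ A → map (renFm ρ) Δ ⊢ renFm ρ A
  ⊢-renFm {Δ = Δ} {A = A} ρ d =
    subst₂ _⊢_ (Listₚ.map-cong (sym ∘ renFm≡subFm ρ) Δ) (sym (renFm≡subFm ρ A))
      (⊢-subFm d (toSub ρ))

  ⊢-wk : Δ ⊢ A → map (wk {τ = σ}) Δ ⊢ wk A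
  ⊢-wk = ⊢-renFm there

  -- Δ is closed off as the premises of one implication, which are then
  -- discharged one by one.
  cut : (∀ {D} → D ∈ Δ → Δ' ⊢ D) → Δ ⊢ A → Δ' ⊢ A
  cut {Δ = Δ} h d = discharge Δ h (weaken (λ ()) (deduce Δ d))
    where
    impAll : List (Fm Γ) → Fm Γ → Fm Γ
    impAll []      A = A
    impAll (D ∷ Δ) A = impAll Δ (D ⊃ A)

    deduce : (Δ : List (Fm Γ)) → Δ ⊢ A → [] ⊢ impAll Δ A
    deduce []      d = d
    deduce (D ∷ Δ) d = deduce Δ (⊃I d)

    discharge : (Δ : List (Fm Γ)) → (∀ {D} → D ∈ Δ → Δ' ⊢ D) → Δ' ⊢ impAll Δ A → Δ' ⊢ A
    discharge []      h d = d
    discharge (D ∷ Δ) h d = ⊃E (discharge Δ (h ∘ there) d) (h (here refl))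

  _⟹_ : Fm Γ → Fm Γ → Set
  _⟹_ {Γ} X Y = ∀ {Δ : List (Fm Γ)} → Δ ⊢ X → Δ ⊢ Y

  ≡⇒⟹ : {X Y : Fm Γ} → X ≡ Y → X ⟹ Y
  ≡⇒⟹ e = subst (_ ⊢_) e

  ⊤' : Fm Γ
  ⊤' = ⊥' ⊃ ⊥'

  ⊤I : Δ ⊢ ⊤'
  ⊤I = ⊃I (hyp (here refl))

  ∧-mono : A ⟹ A' → B ⟹ B' → A ∧' B ⟹ A' ∧' B'
  ∧-mono f g d = ∧I (f (∧E₁ d)) (g (∧E₂ d))

  ∨-mono : A ⟹ A' → B ⟹ B' → A ∨' B ⟹ A' ∨' B'
  ∨-mono f g d = ∨E d (∨I₁ (f (hyp (here refl)))) (∨I₂ (g (hyp (here refl))))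

  ⊃-mono : A' ⟹ A → B ⟹ B' → A ⊃ B ⟹ A' ⊃ B'
  ⊃-mono f g d = ⊃I (g (⊃E (wkHyp d) (f (hyp (here refl)))))

  ∀-unwrap : Δ ⊢ ∀' σ X → map wk Δ ⊢ X
  ∀-unwrap {X = X} d = ≡⇒⟹ (ext-there-[here] X) (∀E (⊢-wk d) (var here))

  ∀-mono : X ⟹ Y → ∀' σ X ⟹ ∀' σ Y
  ∀-mono f d = ∀I (f (∀-unwrap d))

  ∃-mono : X ⟹ Y → ∃' σ X ⟹ ∃' σ Y
  ∃-mono {Y = Y} f d = ∃E d (∃I (var here) (≡⇒⟹ (sym (ext-there-[here] Y)) (f (hyp (here refl)))))

  ∀∈⇒∀ : {t : Tm Γ (σ *)} → ∀∈ t X ⟹ ∀' σ (var here ∈' wkTm t ⊃ X)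
  ∀∈⇒∀ {X = X} {t = t} = ⊃E (∧E₁ (ax (∀∈-def t X)))

  ∀⇒∀∈ : {t : Tm Γ (σ *)} → ∀' σ (var here ∈' wkTm t ⊃ X) ⟹ ∀∈ t X
  ∀⇒∀∈ {X = X} {t = t} = ⊃E (∧E₂ (ax (∀∈-def t X)))

  ∃∈⇒∃ : {t : Tm Γ (σ *)} → ∃∈ t X ⟹ ∃' σ (var here ∈' wkTm t ∧' X)
  ∃∈⇒∃ {X = X} {t = t} = ⊃E (∧E₁ (ax (∃∈-def t X)))

  ∃⇒∃∈ : {t : Tm Γ (σ *)} → ∃' σ (var here ∈' wkTm t ∧' X) ⟹ ∃∈ t X
  ∃⇒∃∈ {X = X} {t = t} = ⊃E (∧E₂ (ax (∃∈-def t X)))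

  ∀∈-mono : {t : Tm Γ (σ *)} → X ⟹ Y → ∀∈ t X ⟹ ∀∈ t Y
  ∀∈-mono f = ∀⇒∀∈ ∘ ∀-mono (⊃-mono (λ d → d) f) ∘ ∀∈⇒∀

  ∃∈-mono : {t : Tm Γ (σ *)} → X ⟹ Y → ∃∈ t X ⟹ ∃∈ t Y
  ∃∈-mono f = ∃⇒∃∈ ∘ ∃-mono (∧-mono (λ d → d) f) ∘ ∃∈⇒∃

  ∈-wk-[] : {u : Tm Γ σ} {t : Tm Γ (σ *)} → Δ ⊢ u ∈' t → Δ ⊢ (var here ∈' wkTm t) [ u ]
  ∈-wk-[] {u = u} {t = t} = ≡⇒⟹ (cong (u ∈'_) (sym (single-wkTm u t)))

  ∀∈-intro : {t : Tm Γ (σ *)} → var here ∈' wkTm t ∷ map wk Δ ⊢ X → Δ ⊢ ∀∈ t X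
  ∀∈-intro d = ∀⇒∀∈ (∀I (⊃I d))

  ∀∈-elim : {t : Tm Γ (σ *)} → Δ ⊢ ∀∈ t X → (u : Tm Γ σ) → Δ ⊢ u ∈' t → Δ ⊢ X [ u ]
  ∀∈-elim d u m = ⊃E (∀E (∀∈⇒∀ d) u) (∈-wk-[] m)

  ∀∈-unwrap : {t : Tm Γ (σ *)} → Δ ⊢ ∀∈ t X → var here ∈' wkTm t ∷ map wk Δ ⊢ X
  ∀∈-unwrap {X = X} d = ⊃E (wkHyp (∀-unwrap (∀∈⇒∀ d))) (hyp (here refl))

  ∃∈-intro : {t : Tm Γ (σ *)} (u : Tm Γ σ) → Δ ⊢ u ∈' t → Δ ⊢ X [ u ] → Δ ⊢ ∃∈ t X
  ∃∈-intro u m d = ∃⇒∃∈ (∃I u (∧I (∈-wk-[] m) d))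

  ∃∈-elim : {t : Tm Γ (σ *)} → Δ ⊢ ∃∈ t X →
            X ∷ var here ∈' wkTm t ∷ map wk Δ ⊢ wk C → Δ ⊢ C
  ∃∈-elim d e = ∃E (∃∈⇒∃ d) (cut uncurried e)
    where
    uncurried : ∀ {D} → D ∈ _ → _ ⊢ D
    uncurried (here refl)         = ∧E₂ (hyp (here refl))
    uncurried (there (here refl)) = ∧E₁ (hyp (here refl))
    uncurried (there (there p))   = hyp (there p)

  ≐-subst : (A : Fm (σ ∷ Γ)) → Atomic A → {t s : Tm Γ σ} →
            Δ ⊢ t ≐ s → Δ ⊢ A [ t ] → Δ ⊢ A [ s ]
  ≐-subst A at {t} {s} e d = ⊃E (ax (eq-subst A at t s)) (∧I e d)

  ≐-refl : (t : Tm Γ σ) → Δ ⊢ t ≐ t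
  ≐-refl t = ax (eq-refl t)

  ≐-sym : {t s : Tm Γ σ} → Δ ⊢ t ≐ s → Δ ⊢ s ≐ t
  ≐-sym {t = t} {s} e = subst (λ Z → _ ⊢ s ≐ Z) (single-wkTm s t)
    (≐-subst (var here ≐ wkTm t) (at-≐ _ _) e
      (subst (λ Z → _ ⊢ t ≐ Z) (sym (single-wkTm t t)) (≐-refl t)))

  ≐-trans : {t s r : Tm Γ σ} → Δ ⊢ t ≐ s → Δ ⊢ s ≐ r → Δ ⊢ t ≐ r
  ≐-trans {t = t} {s} {r} e e' = subst (λ Z → _ ⊢ Z ≐ r) (single-wkTm r t)
    (≐-subst (wkTm t ≐ var here) (at-≐ _ _) e' (subst (λ Z → _ ⊢ Z ≐ s) (sym (single-wkTm s t)) e))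

  ·-congˡ : {f g : Tm Γ (σ ⇒ τ)} (t : Tm Γ σ) → Δ ⊢ f ≐ g → Δ ⊢ f · t ≐ g · t
  ·-congˡ {Δ = Δ} {f = f} {g} t e =
    subst₂ (λ Y Z → Δ ⊢ Y ≐ g · Z) (single-wkTm g (f · t)) (single-wkTm g t)
      (≐-subst (wkTm (f · t) ≐ var here · wkTm t) (at-≐ _ _) e
        (subst₂ (λ Y Z → Δ ⊢ Y ≐ f · Z) (sym (single-wkTm f (f · t))) (sym (single-wkTm f t))
          (≐-refl (f · t))))

  ·-congʳ : (f : Tm Γ (σ ⇒ τ)) {t s : Tm Γ σ} → Δ ⊢ t ≐ s → Δ ⊢ f · t ≐ f · s
  ·-congʳ {Δ = Δ} f {t} {s} e =
    subst₂ (λ Y Z → Δ ⊢ Y ≐ Z · s) (single-wkTm s (f · t)) (single-wkTm s f)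
      (≐-subst (wkTm (f · t) ≐ wkTm f · var here) (at-≐ _ _) e
        (subst₂ (λ Y Z → Δ ⊢ Y ≐ Z · t) (sym (single-wkTm t (f · t))) (sym (single-wkTm t f))
          (≐-refl (f · t))))

  ·-cong : {f g : Tm Γ (σ ⇒ τ)} {t s : Tm Γ σ} →
           Δ ⊢ f ≐ g → Δ ⊢ t ≐ s → Δ ⊢ f · t ≐ g · s
  ·-cong {g = g} {t = t} e e' = ≐-trans (·-congˡ t e) (·-congʳ g e')

  ∈-congʳ : {a : Tm Γ σ} {X Y : Tm Γ (σ *)} → Δ ⊢ X ≐ Y → Δ ⊢ a ∈' X → Δ ⊢ a ∈' Y
  ∈-congʳ {a = a} {X} {Y} e d = subst (λ Z → _ ⊢ Z ∈' Y) (single-wkTm Y a)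
    (≐-subst (wkTm a ∈' var here) (at-∈ _ _) e (subst (λ Z → _ ⊢ Z ∈' X) (sym (single-wkTm X a)) d))

  ∈-sng : (t : Tm Γ σ) → Δ ⊢ t ∈' con (sng σ) · t
  ∈-sng t = ⊃E (∧E₂ (ax (sng-ax t t))) (≐-refl t)

  map-renFm-wkBy : (Xs : Ctx) (Δ : List (Fm Θ)) →
                   map wk (map (renFm (wkBy Xs)) Δ) ≡ map (renFm (wkBy (σ ∷ Xs))) Δ
  map-renFm-wkBy Xs Δ = trans (sym (Listₚ.map-∘ Δ)) (Listₚ.map-cong (renFm-∘ (wkBy Xs) there) Δ)

  map-renFm-id : (Δ : List (Fm Θ)) → map (renFm (wkBy [])) Δ ≡ Δ
  map-renFm-id Δ =
    trans (Listₚ.map-cong (λ D → trans (renFm≡subFm _ D) (subFm-id D)) Δ) (Listₚ.map-id Δ)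

  Alls-intro : ∀ (Xs : Ctx) {Δ : List (Fm Θ)} {B} → map (renFm (wkBy Xs)) Δ ⊢ B → Δ ⊢ Alls Xs B
  Alls-intro []            {Δ} d = subst (_⊢ _) (map-renFm-id Δ) d
  Alls-intro (σ ∷ Xs) {Δ} d = Alls-intro Xs (∀I (subst (_⊢ _) (sym (map-renFm-wkBy Xs Δ)) d))

  Alls-unwrap : ∀ (Xs : Ctx) {Δ : List (Fm Θ)} {B} → Δ ⊢ Alls Xs B → map (renFm (wkBy Xs)) Δ ⊢ B
  Alls-unwrap []       {Δ} d = subst (_⊢ _) (sym (map-renFm-id Δ)) d
  Alls-unwrap (σ ∷ Xs) {Δ} d = subst (_⊢ _) (map-renFm-wkBy Xs Δ) (∀-unwrap (Alls-unwrap Xs d))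

  Alls-elim : ∀ (Xs : Ctx) {Δ : List (Fm Θ)} {B} →
              Δ ⊢ Alls Xs B → (as : Tms Θ Xs) → Δ ⊢ subFm (as ⊕ var) B
  Alls-elim []       {B = B} d []       = ≡⇒⟹ (sym (subFm-id B)) d
  Alls-elim (σ ∷ Xs) {B = B} d (a ∷ as) = ≡⇒⟹ instantiate (∀E (Alls-elim Xs d as) a)
    where
    pointwise : exts (as ⊕ var) ⨾ single a ≗ˢ (a ∷ as) ⊕ var
    pointwise here      = refl
    pointwise (there x) = single-wkTm a _
    instantiate : subFm (exts (as ⊕ var)) B [ a ] ≡ subFm ((a ∷ as) ⊕ var) B
    instantiate = trans (subFm-∘ _ _ B) (subFm-cong pointwise B)

module Combinators (L : Language) (T : Syn.Theory L) where
  open Language L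
  open Syn L
  open Substitution L
  open DerivedRules L T

  private variable
    Γ Θ Θ' : Ctx
    σ τ : Ty
    Xs : List Ty
    Δ : List (Fm Γ)

  -- Bracket abstraction, with Π and Σ playing the roles of K and S.
  lam : Tm (σ ∷ Γ) τ → Tm Γ (σ ⇒ τ)
  lam {σ = σ}         (var here)      = con (Σc σ (σ ⇒ σ) σ) · con (Πc σ (σ ⇒ σ)) · con (Πc σ σ)
  lam {σ = σ} {τ = τ} (var (there x)) = con (Πc τ σ) · var x
  lam {σ = σ} {τ = τ} (con c)         = con (Πc τ σ) · con c
  lam {σ = σ} {τ = τ} (_·_ {ρ} t u)   = con (Σc σ ρ τ) · lam t · lam u

  lam-renTm : (ρ : Ren Γ Θ) (t : Tm (σ ∷ Γ) τ) → renTm ρ (lam t) ≡ lam (renTm (ext ρ) t)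
  lam-renTm ρ (var here)      = refl
  lam-renTm ρ (var (there x)) = refl
  lam-renTm ρ (con c)         = refl
  lam-renTm ρ (t · u)         = cong₂ (λ X Y → con _ · X · Y) (lam-renTm ρ t) (lam-renTm ρ u)

  β : {Δ : List (Fm Θ)} (t : Tm (σ ∷ Γ) τ) (s : Sub Γ Θ) (a : Tm Θ σ) →
      Δ ⊢ subTm s (lam t) · a ≐ subTm ((a ∷ []) ⊕ s) t
  β (var here)      s a = ≐-trans (ax (Σ-ax _ _ a)) (ax (Π-ax a _))
  β (var (there x)) s a = ax (Π-ax _ a)
  β (con c)         s a = ax (Π-ax _ a)
  β (t · u)         s a = ≐-trans (ax (Σ-ax _ _ a)) (·-cong (β t s a) (β u s a))

  β-single : (t : Tm (σ ∷ Γ) τ) (a : Tm Γ σ) → Δ ⊢ lam t · a ≐ subTm (single a) t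
  β-single {Δ = Δ} t a =
    subst₂ (λ X Y → Δ ⊢ X · a ≐ Y) (subTm-id (lam t)) (subTm-cong pointwise t) (β t var a)
    where
    pointwise : (a ∷ []) ⊕ var ≗ˢ single a
    pointwise here      = refl
    pointwise (there x) = refl

  β-here : {Δ : List (Fm (σ ∷ Γ))} (t : Tm (σ ∷ Γ) τ) → Δ ⊢ wkTm (lam t) · var here ≐ t
  β-here {Δ = Δ} t = subst₂ (λ X Y → Δ ⊢ X · var here ≐ Y)
    (sym (renTm≡subTm there (lam t))) (trans (subTm-cong pointwise t) (subTm-id t))
    (β t (toSub there) (var here))
    where
    pointwise : (var here ∷ []) ⊕ toSub there ≗ˢ var
    pointwise here      = refl
    pointwise (there x) = refl

  Λ : (Xs : Ctx) → Tm (Xs ++ Θ) τ → Tm Θ (Xs ⇛ τ)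
  Λ []       t = t
  Λ (σ ∷ Xs) t = Λ Xs (lam t)

  appAll : {Xs : Ctx} → Tm Γ (Xs ⇛ τ) → Tms Γ Xs → Tm Γ τ
  appAll f []       = f
  appAll f (a ∷ as) = appAll f as · a

  βΛ : {Δ : List (Fm Θ')} (Xs : Ctx) (t : Tm (Xs ++ Θ) τ) (s : Sub Θ Θ') (as : Tms Θ' Xs) →
       Δ ⊢ appAll (subTm s (Λ Xs t)) as ≐ subTm (as ⊕ s) t
  βΛ []       t s []       = ≐-refl _
  βΛ {Δ = Δ} (σ ∷ Xs) t s (a ∷ as) = ≐-trans (·-congˡ a (βΛ Xs (lam t) s as))
    (subst (λ X → Δ ⊢ subTm (as ⊕ s) (lam t) · a ≐ X) (subTm-cong pointwise t) (β t (as ⊕ s) a))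
    where
    pointwise : (a ∷ []) ⊕ (as ⊕ s) ≗ˢ (a ∷ as) ⊕ s
    pointwise here      = refl
    pointwise (there x) = refl

  ⊕-wkBy-vars : (Xs : Ctx) → vars Xs ⊕ toSub (wkBy {Θ} Xs) ≗ˢ var
  ⊕-wkBy-vars []       x         = refl
  ⊕-wkBy-vars (σ ∷ Xs) here      = refl
  ⊕-wkBy-vars (σ ∷ Xs) (there x) =
    trans (⊕-renTm there (vars Xs) (toSub (wkBy Xs)) x) (cong wkTm (⊕-wkBy-vars Xs x))

  βΛ-vars : (Xs : Ctx) {Δ : List (Fm (Xs ++ Θ))} (t : Tm (Xs ++ Θ) τ) →
            Δ ⊢ appAll (renTm (wkBy Xs) (Λ Xs t)) (vars Xs) ≐ t
  βΛ-vars Xs {Δ} t = subst₂ (λ X Y → Δ ⊢ appAll X (vars Xs) ≐ Y)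
    (sym (renTm≡subTm (wkBy Xs) (Λ Xs t))) (trans (subTm-cong (⊕-wkBy-vars Xs) t) (subTm-id t))
    (βΛ Xs t (toSub (wkBy Xs)) (vars Xs))

  inh : (τ : Ty) → Tm Γ τ
  inh G       = con (fun const₀)
  inh (σ ⇒ τ) = con (Πc τ σ) · inh τ
  inh (σ *)   = con (sng σ) · inh σ

  inhs : (Xs : List Ty) → Tms Γ Xs
  inhs []       = []
  inhs (τ ∷ Xs) = inh τ ∷ inhs Xs

  appEach : ∀ {Xs} (Ys : List Ty) → Tms Θ (map (Xs ⇛_) Ys) → Tms Θ Xs → Tms Θ Ys
  appEach []       []       as = []
  appEach (τ ∷ Ys) (f ∷ fs) as = appAll f as ∷ appEach Ys fs as

  appHere : (Ys : List Ty) → Tms Θ (map (σ ⇒_) Ys) → Tms (σ ∷ Θ) Ys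
  appHere []       []       = []
  appHere (τ ∷ Ys) (f ∷ fs) = wkTm f · var here ∷ appHere Ys fs

  ΛEach : (Xs Ys : List Ty) → Tms (Xs ++ Θ) Ys → Tms Θ (map (Xs ⇛_) Ys)
  ΛEach Xs []       []       = []
  ΛEach Xs (τ ∷ Ys) (t ∷ ts) = Λ Xs t ∷ ΛEach Xs Ys ts

  lamEach : (Ys : List Ty) → Tms (σ ∷ Θ) Ys → Tms Θ (map (σ ⇒_) Ys)
  lamEach []       []       = []
  lamEach (τ ∷ Ys) (t ∷ ts) = lam t ∷ lamEach Ys ts

  appAll-subTm : (s : Sub Γ Θ) (f : Tm Γ (Xs ⇛ τ)) (as : Tms Γ Xs) →
                 subTm s (appAll f as) ≡ appAll (subTm s f) (All.map (subTm s) as)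
  appAll-subTm s f []       = refl
  appAll-subTm s f (a ∷ as) = cong (_· subTm s a) (appAll-subTm s f as)

  appEach-subTm : (Ys : List Ty) (s : Sub Γ Θ) (fs : Tms Γ (map (Xs ⇛_) Ys)) (as : Tms Γ Xs) →
                  All.map (subTm s) (appEach Ys fs as) ≡ appEach Ys (All.map (subTm s) fs) (All.map (subTm s) as)
  appEach-subTm []       s []       as = refl
  appEach-subTm (τ ∷ Ys) s (f ∷ fs) as = cong₂ _∷_ (appAll-subTm s f as) (appEach-subTm Ys s fs as)

  appHere-subTm : (Ys : List Ty) (s : Sub Γ Θ) (fs : Tms Γ (map (σ ⇒_) Ys)) →
                  All.map (subTm (exts s)) (appHere Ys fs) ≡ appHere Ys (All.map (subTm s) fs)
  appHere-subTm []       s []       = refl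
  appHere-subTm (τ ∷ Ys) s (f ∷ fs) =
    cong₂ _∷_ (cong (_· var here) (wkTm-subTm s f)) (appHere-subTm Ys s fs)

module Majorizability (L : Language) (T : Syn.Theory L) where
  open Syn L
  open Substitution L
  open DerivedRules L T
  open Combinators L T

  private variable
    Γ Θ : Ctx
    σ τ ρ : Ty
    Xs Ys : List Ty
    Δ : List (Fm Γ)

  infix 6 _⊑_ _⊑⋆_
  infixl 7 _⊔_

  _⊑_ : Tm Γ τ → Tm Γ τ → Fm Γ
  _⊑_ {τ = G}     a b = ⊤'
  _⊑_ {τ = σ *}   a b = ∀∈ a (var here ∈' wkTm b)
  _⊑_ {τ = ρ ⇒ τ} a b = ∀' ρ (wkTm a · var here ⊑ wkTm b · var here)

  ⊑-subFm : (τ : Ty) (s : Sub Γ Θ) (a b : Tm Γ τ) → subFm s (a ⊑ b) ≡ subTm s a ⊑ subTm s b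
  ⊑-subFm G       s a b = refl
  ⊑-subFm (σ *)   s a b = cong (λ X → ∀∈ (subTm s a) (var here ∈' X)) (wkTm-subTm s b)
  ⊑-subFm (ρ ⇒ τ) s a b = cong (∀' ρ) (trans (⊑-subFm τ (exts s) _ _)
    (cong₂ (λ X Y → X · var here ⊑ Y · var here) (wkTm-subTm s a) (wkTm-subTm s b)))

  ⊑-renFm : (τ : Ty) (ρ : Ren Γ Θ) (a b : Tm Γ τ) → renFm ρ (a ⊑ b) ≡ renTm ρ a ⊑ renTm ρ b
  ⊑-renFm τ ρ a b = trans (renFm≡subFm ρ (a ⊑ b))
    (trans (⊑-subFm τ _ a b) (sym (cong₂ _⊑_ (renTm≡subTm ρ a) (renTm≡subTm ρ b))))

  ⊑-refl : (τ : Ty) (a : Tm Γ τ) → Δ ⊢ a ⊑ a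
  ⊑-refl G       a = ⊤I
  ⊑-refl (σ *)   a = ∀∈-intro (hyp (here refl))
  ⊑-refl (ρ ⇒ τ) a = ∀I (⊑-refl τ _)

  ⊑-respʳ : (τ : Ty) {a b b' : Tm Γ τ} → Δ ⊢ b ≐ b' → Δ ⊢ a ⊑ b → Δ ⊢ a ⊑ b'
  ⊑-respʳ G       e d = ⊤I
  ⊑-respʳ (σ *)   e d = ∀∈-intro (∈-congʳ (wkHyp (⊢-wk e)) (∀∈-unwrap d))
  ⊑-respʳ (ρ ⇒ τ) e d = ∀I (⊑-respʳ τ (·-congˡ (var here) (⊢-wk e)) (∀-unwrap d))

  ⊑-respˡ : (τ : Ty) {a a' b : Tm Γ τ} → Δ ⊢ a ≐ a' → Δ ⊢ a ⊑ b → Δ ⊢ a' ⊑ b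
  ⊑-respˡ G       e d = ⊤I
  ⊑-respˡ (σ *)   e d = ∀∈-intro
    (⊃E (wkHyp (∀-unwrap (∀∈⇒∀ d))) (∈-congʳ (wkHyp (⊢-wk (≐-sym e))) (hyp (here refl))))
  ⊑-respˡ (ρ ⇒ τ) e d = ∀I (⊑-respˡ τ (·-congˡ (var here) (⊢-wk e)) (∀-unwrap d))

  ≐⇒⊑ : (τ : Ty) {a b : Tm Γ τ} → Δ ⊢ a ≐ b → Δ ⊢ a ⊑ b
  ≐⇒⊑ τ e = ⊑-respʳ τ e (⊑-refl τ _)

  ⊑-app : {a b : Tm Γ (ρ ⇒ τ)} → Δ ⊢ a ⊑ b → (c : Tm Γ ρ) → Δ ⊢ a · c ⊑ b · c
  ⊑-app {τ = τ} {a = a} {b = b} d c = ≡⇒⟹ instantiate (∀E d c)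
    where
    instantiate : (wkTm a · var here ⊑ wkTm b · var here) [ c ] ≡ a · c ⊑ b · c
    instantiate =
      trans (⊑-subFm τ _ _ _) (cong₂ (λ X Y → X · c ⊑ Y · c) (single-wkTm c a) (single-wkTm c b))

  ⊑-appAll : (Xs : Ctx) {τ : Ty} {a b : Tm Γ (Xs ⇛ τ)} → Δ ⊢ a ⊑ b →
             (cs : Tms Γ Xs) → Δ ⊢ appAll a cs ⊑ appAll b cs
  ⊑-appAll []       d []       = d
  ⊑-appAll (σ ∷ Xs) d (c ∷ cs) = ⊑-app (⊑-appAll Xs d cs) c

  _⊔_ : Tm Γ τ → Tm Γ τ → Tm Γ τ
  _⊔_ {τ = G}     a b = a
  _⊔_ {τ = σ *}   a b = con (cup σ) · a · b
  _⊔_ {τ = ρ ⇒ τ} a b = lam (wkTm a · var here ⊔ wkTm b · var here)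

  ⊑-⊔ˡ : (τ : Ty) (a b : Tm Γ τ) → Δ ⊢ a ⊑ a ⊔ b
  ⊑-⊔ˡ G       a b = ⊤I
  ⊑-⊔ˡ (σ *)   a b =
    ∀∈-intro (⊃E (∧E₂ (ax (cup-ax (var here) (wkTm a) (wkTm b)))) (∨I₁ (hyp (here refl))))
  ⊑-⊔ˡ (ρ ⇒ τ) a b = ∀I (⊑-respʳ τ (≐-sym (β-here _)) (⊑-⊔ˡ τ _ _))

  ⊑-⊔ʳ : (τ : Ty) (a b : Tm Γ τ) → Δ ⊢ b ⊑ a ⊔ b
  ⊑-⊔ʳ G       a b = ⊤I
  ⊑-⊔ʳ (σ *)   a b =
    ∀∈-intro (⊃E (∧E₂ (ax (cup-ax (var here) (wkTm a) (wkTm b)))) (∨I₂ (hyp (here refl))))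
  ⊑-⊔ʳ (ρ ⇒ τ) a b = ∀I (⊑-respʳ τ (≐-sym (β-here _)) (⊑-⊔ʳ τ _ _))

  ⋃ : (τ : Ty) → Tm Γ (σ *) → Tm Γ (σ ⇒ τ) → Tm Γ τ
  ⋃ G                   w f = inh G
  ⋃ {σ = σ} (ρ *)       w f = con (bigcup σ ρ) · w · f
  ⋃ (ρ ⇒ τ)             w f = lam (⋃ τ (wkTm w) (lam (wkTm (wkTm f) · var here · var (there here))))

  ⋃-renTm : (τ : Ty) (ρ : Ren Γ Θ) (w : Tm Γ (σ *)) (f : Tm Γ (σ ⇒ τ)) →
            renTm ρ (⋃ τ w f) ≡ ⋃ τ (renTm ρ w) (renTm ρ f)
  ⋃-renTm G       ρ w f = refl
  ⋃-renTm (_ *)   ρ w f = refl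
  ⋃-renTm (_ ⇒ τ) ρ w f = trans (lam-renTm ρ _) (cong lam (trans (⋃-renTm τ (ext ρ) (wkTm w) _)
    (cong₂ (⋃ τ) (wkTm-renTm ρ w) (trans (lam-renTm (ext ρ) (wkTm (wkTm f) · var here · var (there here)))
      (cong (λ X → lam (X · var here · var (there here)))
            (trans (wkTm-renTm (ext ρ) (wkTm f)) (cong wkTm (wkTm-renTm ρ f))))))))

  ⊑-⋃ : {σ : Ty} (τ : Ty) {y : Tm Γ σ} {w : Tm Γ (σ *)} (f : Tm Γ (σ ⇒ τ)) →
        Δ ⊢ y ∈' w → Δ ⊢ f · y ⊑ ⋃ τ w f
  ⊑-⋃ G       f m = ⊤I
  ⊑-⋃ (ρ *)   {y} {w} f m =
    ∀∈-intro (⊃E (ax (bigcup-ax (wkTm y) (wkTm w) (var here) (wkTm f)))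
                 (∧I (wkHyp (⊢-wk m)) (hyp (here refl))))
  ⊑-⋃ {Γ = Γ} {Δ = Δ} {σ = σ} (ρ ⇒ τ) {y} f m =
    ∀I (⊑-respʳ τ (≐-sym (β-here _)) (⊑-respˡ τ swap (⊑-⋃ τ _ (⊢-wk m))))
    where
    body : Tm (σ ∷ ρ ∷ Γ) τ
    body = wkTm (wkTm f) · var here · var (there here)
    swap : map wk Δ ⊢ lam body · wkTm y ≐ wkTm f · wkTm y · var here
    swap = subst (λ X → map wk Δ ⊢ lam body · wkTm y ≐ X · wkTm y · var here)
      (single-wkTm (wkTm y) (wkTm f)) (β-single body (wkTm y))

  _⊑⋆_ : Tms Γ Xs → Tms Γ Xs → Fm Γ
  []       ⊑⋆ []       = ⊤'
  (a ∷ as) ⊑⋆ (b ∷ bs) = a ⊑ b ∧' as ⊑⋆ bs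

  ⊑⋆-renFm : (Xs : List Ty) (ρ : Ren Γ Θ) (as bs : Tms Γ Xs) →
             renFm ρ (as ⊑⋆ bs) ≡ All.map (renTm ρ) as ⊑⋆ All.map (renTm ρ) bs
  ⊑⋆-renFm []       ρ []       []       = refl
  ⊑⋆-renFm (τ ∷ Xs) ρ (a ∷ as) (b ∷ bs) = cong₂ _∧'_ (⊑-renFm τ ρ a b) (⊑⋆-renFm Xs ρ as bs)

  ⊢-⊑⋆-renFm : (Xs : List Ty) (ρ : Ren Γ Θ) {as bs : Tms Γ Xs} →
               Δ ⊢ as ⊑⋆ bs → map (renFm ρ) Δ ⊢ All.map (renTm ρ) as ⊑⋆ All.map (renTm ρ) bs
  ⊢-⊑⋆-renFm Xs ρ {as} {bs} d = ≡⇒⟹ (⊑⋆-renFm Xs ρ as bs) (⊢-renFm ρ d)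

  ⊑⋆-++⁻ˡ : (Xs : List Ty) {as bs : Tms Γ (Xs ++ Ys)} →
            Δ ⊢ as ⊑⋆ bs → Δ ⊢ Allₚ.++⁻ˡ Xs as ⊑⋆ Allₚ.++⁻ˡ Xs bs
  ⊑⋆-++⁻ˡ []       d = ⊤I
  ⊑⋆-++⁻ˡ (τ ∷ Xs) {as = a ∷ as} {b ∷ bs} d = ∧I (∧E₁ d) (⊑⋆-++⁻ˡ Xs (∧E₂ d))

  ⊑⋆-++⁻ʳ : (Xs : List Ty) {as bs : Tms Γ (Xs ++ Ys)} →
            Δ ⊢ as ⊑⋆ bs → Δ ⊢ Allₚ.++⁻ʳ Xs as ⊑⋆ Allₚ.++⁻ʳ Xs bs
  ⊑⋆-++⁻ʳ []       d = d
  ⊑⋆-++⁻ʳ (τ ∷ Xs) {as = a ∷ as} {b ∷ bs} d = ⊑⋆-++⁻ʳ Xs (∧E₂ d)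

  ⊑⋆-appEach : (Ys : List Ty) {fs gs : Tms Γ (map (Xs ⇛_) Ys)} →
               Δ ⊢ fs ⊑⋆ gs → (cs : Tms Γ Xs) → Δ ⊢ appEach Ys fs cs ⊑⋆ appEach Ys gs cs
  ⊑⋆-appEach []       {[]}     {[]}     d cs = ⊤I
  ⊑⋆-appEach {Xs = Xs} (τ ∷ Ys) {f ∷ fs} {g ∷ gs} d cs =
    ∧I (⊑-appAll Xs (∧E₁ d) cs) (⊑⋆-appEach Ys (∧E₂ d) cs)

  ⊑⋆-appHere : (Ys : List Ty) {fs gs : Tms Γ (map (σ ⇒_) Ys)} →
               Δ ⊢ fs ⊑⋆ gs → map wk Δ ⊢ appHere Ys fs ⊑⋆ appHere Ys gs
  ⊑⋆-appHere []       {[]}     {[]}     d = ⊤I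
  ⊑⋆-appHere (τ ∷ Ys) {f ∷ fs} {g ∷ gs} d = ∧I (∀-unwrap (∧E₁ d)) (⊑⋆-appHere Ys (∧E₂ d))

  ⊑⋆-ΛEach : (Xs Ys : List Ty) {Δ : List (Fm (Xs ++ Θ))} (ts : Tms (Xs ++ Θ) Ys) →
             Δ ⊢ ts ⊑⋆ appEach Ys (All.map (renTm (wkBy Xs)) (ΛEach Xs Ys ts)) (vars Xs)
  ⊑⋆-ΛEach Xs []       []       = ⊤I
  ⊑⋆-ΛEach Xs (τ ∷ Ys) (t ∷ ts) = ∧I (≐⇒⊑ τ (≐-sym (βΛ-vars Xs t))) (⊑⋆-ΛEach Xs Ys ts)

  ⊑⋆-lamEach : (Ys : List Ty) {Δ : List (Fm (σ ∷ Θ))} (ts : Tms (σ ∷ Θ) Ys) →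
               Δ ⊢ ts ⊑⋆ appHere Ys (lamEach Ys ts)
  ⊑⋆-lamEach []       []       = ⊤I
  ⊑⋆-lamEach (τ ∷ Ys) (t ∷ ts) = ∧I (≐⇒⊑ τ (≐-sym (β-here t))) (⊑⋆-lamEach Ys ts)

  _⊔⋆_ : Tms Γ Ys → Tms Γ Ys → Tms Γ Ys
  []       ⊔⋆ []       = []
  (a ∷ as) ⊔⋆ (b ∷ bs) = a ⊔ b ∷ as ⊔⋆ bs

  ⊑⋆-⊔⋆ˡ : (Ys : List Ty) (as bs : Tms Γ Ys) → Δ ⊢ as ⊑⋆ as ⊔⋆ bs
  ⊑⋆-⊔⋆ˡ []       []       []       = ⊤I
  ⊑⋆-⊔⋆ˡ (τ ∷ Ys) (a ∷ as) (b ∷ bs) = ∧I (⊑-⊔ˡ τ a b) (⊑⋆-⊔⋆ˡ Ys as bs)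

  ⊑⋆-⊔⋆ʳ : (Ys : List Ty) (as bs : Tms Γ Ys) → Δ ⊢ bs ⊑⋆ as ⊔⋆ bs
  ⊑⋆-⊔⋆ʳ []       []       []       = ⊤I
  ⊑⋆-⊔⋆ʳ (τ ∷ Ys) (a ∷ as) (b ∷ bs) = ∧I (⊑-⊔ʳ τ a b) (⊑⋆-⊔⋆ʳ Ys as bs)

  ⋃⋆ : (Ys : List Ty) → Tm Θ (σ *) → Tms (σ ∷ Θ) Ys → Tms Θ Ys
  ⋃⋆ []       w []       = []
  ⋃⋆ (τ ∷ Ys) w (t ∷ ts) = ⋃ τ w (lam t) ∷ ⋃⋆ Ys w ts

  ⊑⋆-⋃⋆ : {Δ : List (Fm (σ ∷ Θ))} (Ys : List Ty) (w : Tm Θ (σ *)) (ts : Tms (σ ∷ Θ) Ys) →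
          Δ ⊢ var here ∈' wkTm w → Δ ⊢ ts ⊑⋆ All.map wkTm (⋃⋆ Ys w ts)
  ⊑⋆-⋃⋆ []       w []       m = ⊤I
  ⊑⋆-⋃⋆ (τ ∷ Ys) w (t ∷ ts) m = ∧I
    (⊑-respˡ τ (β-here t) (≡⇒⟹ (cong (_ ⊑_) (sym (⋃-renTm τ there w (lam t)))) (⊑-⋃ τ _ m)))
    (⊑⋆-⋃⋆ Ys w ts m)


module Realizability (L : Language) (T : Syn.Theory L) where
  open Syn L
  open Substitution L
  open DerivedRules L T
  open Combinators L T
  open Majorizability L T

  private variable
    Γ Γ' Θ Θ' : Ctx
    σ τ : Ty
    Xs Ys : List Ty
    Hs : List (Fm Θ)

  -- tp A lists the types of the components of a realizer of A.
  tp : Fm Γ → List Ty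
  tp ⊥'                = []
  tp (t ≐ q)           = []
  tp (t ∈' q)          = []
  tp (rel R ts)        = []
  tp (A ∨' B)          = tp A ++ tp B
  tp (A ∧' B)          = tp A ++ tp B
  tp (A ⊃ B)           = map (tp A ⇛_) (tp B)
  tp (∀' σ A)          = map (σ ⇒_) (tp A)
  tp (∃' σ A)          = σ * ∷ tp A
  tp (∀∈ {σ = σ} t A)  = map (σ ⇒_) (tp A)
  tp (∃∈ t A)          = tp A

  -- Mr A s x is the realizability formula "x mr A" under the substitution s.
  Mr : (A : Fm Γ) → Sub Γ Θ → Tms Θ (tp A) → Fm Θ
  Mr ⊥'         s x       = ⊥'
  Mr (t ≐ q)    s x       = subTm s t ≐ subTm s q
  Mr (t ∈' q)   s x       = subTm s t ∈' subTm s q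
  Mr (rel R ts) s x       = rel R (Vec.map (subTm s) ts)
  Mr (A ∨' B)   s x       = Mr A s (Allₚ.++⁻ˡ (tp A) x) ∨' Mr B s (Allₚ.++⁻ʳ (tp A) x)
  Mr (A ∧' B)   s x       = Mr A s (Allₚ.++⁻ˡ (tp A) x) ∧' Mr B s (Allₚ.++⁻ʳ (tp A) x)
  Mr (A ⊃ B)    s f       = (subFm s A ⊃ subFm s B) ∧'
    Alls (tp A) (Mr A (wkSubBy (tp A) s) (vars (tp A)) ⊃
                Mr B (wkSubBy (tp A) s) (appEach (tp B) (wkTmsBy (tp A) f) (vars (tp A))))
  Mr (∀' σ A)   s f       = ∀' σ (Mr A (exts s) (appHere (tp A) f))
  Mr (∃' σ A)   s (w ∷ x) = ∃∈ w (Mr A (exts s) (All.map wkTm x))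
  Mr (∀∈ t A)   s f       = ∀∈ (subTm s t) (Mr A (exts s) (appHere (tp A) f))
  Mr (∃∈ t A)   s x       = ∃∈ (subTm s t) (Mr A (exts s) (All.map wkTm x))

  Mr-cong : (A : Fm Γ) {s s' : Sub Γ Θ} → s ≗ˢ s' → (x : Tms Θ (tp A)) → Mr A s x ≡ Mr A s' x
  Mr-cong ⊥'         e x       = refl
  Mr-cong (t ≐ q)    e x       = cong₂ _≐_ (subTm-cong e t) (subTm-cong e q)
  Mr-cong (t ∈' q)   e x       = cong₂ _∈'_ (subTm-cong e t) (subTm-cong e q)
  Mr-cong (rel R ts) e x       = cong (rel R) (Vecₚ.map-cong (subTm-cong e) ts)
  Mr-cong (A ∨' B)   e x       = cong₂ _∨'_ (Mr-cong A e _) (Mr-cong B e _)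
  Mr-cong (A ∧' B)   e x       = cong₂ _∧'_ (Mr-cong A e _) (Mr-cong B e _)
  Mr-cong (A ⊃ B)    e f       = cong₂ _∧'_ (cong₂ _⊃_ (subFm-cong e A) (subFm-cong e B))
    (cong (Alls (tp A)) (cong₂ _⊃_ (Mr-cong A (cong (renTm _) ∘ e) _) (Mr-cong B (cong (renTm _) ∘ e) _)))
  Mr-cong (∀' σ A)   e f       = cong (∀' σ) (Mr-cong A (exts-cong e) _)
  Mr-cong (∃' σ A)   e (w ∷ x) = cong (∃∈ w) (Mr-cong A (exts-cong e) _)
  Mr-cong (∀∈ t A)   e f       = cong₂ ∀∈ (subTm-cong e t) (Mr-cong A (exts-cong e) _)
  Mr-cong (∃∈ t A)   e x       = cong₂ ∃∈ (subTm-cong e t) (Mr-cong A (exts-cong e) _)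

  subFm-Mr : (A : Fm Γ) (s : Sub Γ Θ) (v : Sub Θ Θ') (x : Tms Θ (tp A)) →
             subFm v (Mr A s x) ≡ Mr A (s ⨾ v) (All.map (subTm v) x)
  subFm-Mr ⊥'         s v x = refl
  subFm-Mr (t ≐ q)    s v x = cong₂ _≐_ (subTm-∘ s v t) (subTm-∘ s v q)
  subFm-Mr (t ∈' q)   s v x = cong₂ _∈'_ (subTm-∘ s v t) (subTm-∘ s v q)
  subFm-Mr (rel R ts) s v x =
    cong (rel R) (trans (sym (Vecₚ.map-∘ (subTm v) (subTm s) ts)) (Vecₚ.map-cong (subTm-∘ s v) ts))
  subFm-Mr (A ∨' B)   s v x = cong₂ _∨'_
    (trans (subFm-Mr A s v _) (cong (Mr A _) (sym (++⁻ˡ-map (tp A) (subTm v) x))))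
    (trans (subFm-Mr B s v _) (cong (Mr B _) (sym (++⁻ʳ-map (tp A) (subTm v) x))))
  subFm-Mr (A ∧' B)   s v x = cong₂ _∧'_
    (trans (subFm-Mr A s v _) (cong (Mr A _) (sym (++⁻ˡ-map (tp A) (subTm v) x))))
    (trans (subFm-Mr B s v _) (cong (Mr B _) (sym (++⁻ʳ-map (tp A) (subTm v) x))))
  subFm-Mr {Θ = Θ} {Θ' = Θ'} (A ⊃ B) s v f = cong₂ _∧'_ (cong₂ _⊃_ (subFm-∘ s v A) (subFm-∘ s v B))
    (trans (Alls-subFm XA v _) (cong (Alls XA) (cong₂ _⊃_
      (trans (subFm-Mr A _ _ _) (trans (Mr-cong A commute _) (cong (Mr A _) (extsBy-vars XA v))))
      (trans (subFm-Mr B _ _ _) (trans (Mr-cong B commute _) (cong (Mr B _) (begin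
        All.map (subTm v') (appEach (tp B) (wkTmsBy XA f) (vars XA))
          ≡⟨ appEach-subTm (tp B) v' _ _ ⟩
        appEach (tp B) (All.map (subTm v') (wkTmsBy XA f)) (All.map (subTm v') (vars XA))
          ≡⟨ cong₂ (appEach (tp B)) (wkTmsBy-subTm XA v f) (extsBy-vars XA v) ⟩
        appEach (tp B) (wkTmsBy XA (All.map (subTm v) f)) (vars XA) ∎)))))))
    where
    open ≡-Reasoning
    XA : List Ty
    XA = tp A
    v' : Sub (XA ++ Θ) (XA ++ Θ')
    v' = extsBy XA v
    commute : wkSubBy XA s ⨾ v' ≗ˢ wkSubBy XA (s ⨾ v)
    commute y = subTm-extsBy-wkBy XA v (s y)
  subFm-Mr (∀' σ A)   s v f       = cong (∀' σ) (trans (subFm-Mr A _ _ _)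
    (trans (Mr-cong A (exts-⨾ s v) _) (cong (Mr A _) (appHere-subTm (tp A) v f))))
  subFm-Mr (∃' σ A)   s v (w ∷ x) = cong (∃∈ (subTm v w)) (trans (subFm-Mr A _ _ _)
    (trans (Mr-cong A (exts-⨾ s v) _) (cong (Mr A _) (map-wkTm-subTm v x))))
  subFm-Mr (∀∈ t A)   s v f       = cong₂ ∀∈ (subTm-∘ s v t) (trans (subFm-Mr A _ _ _)
    (trans (Mr-cong A (exts-⨾ s v) _) (cong (Mr A _) (appHere-subTm (tp A) v f))))
  subFm-Mr (∃∈ t A)   s v x       = cong₂ ∃∈ (subTm-∘ s v t) (trans (subFm-Mr A _ _ _)
    (trans (Mr-cong A (exts-⨾ s v) _) (cong (Mr A _) (map-wkTm-subTm v x))))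

  renFm-Mr : (A : Fm Γ) (s : Sub Γ Θ) (ρ : Ren Θ Θ') (x : Tms Θ (tp A)) →
             renFm ρ (Mr A s x) ≡ Mr A (renTm ρ ∘ s) (All.map (renTm ρ) x)
  renFm-Mr A s ρ x = trans (renFm≡subFm ρ (Mr A s x)) (trans (subFm-Mr A s _ x)
    (trans (Mr-cong A (sym ∘ renTm≡subTm ρ ∘ s) _)
           (cong (Mr A _) (Allₚ.map-cong x (sym ∘ renTm≡subTm ρ)))))


  tp-subFm : (A : Fm Γ) (u : Sub Γ Γ') → tp (subFm u A) ≡ tp A
  tp-subFm ⊥'         u = refl
  tp-subFm (t ≐ q)    u = refl
  tp-subFm (t ∈' q)   u = refl
  tp-subFm (rel R ts) u = refl
  tp-subFm (A ∨' B)   u = cong₂ _++_ (tp-subFm A u) (tp-subFm B u)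
  tp-subFm (A ∧' B)   u = cong₂ _++_ (tp-subFm A u) (tp-subFm B u)
  tp-subFm (A ⊃ B)    u = cong₂ (λ X Y → map (X ⇛_) Y) (tp-subFm A u) (tp-subFm B u)
  tp-subFm (∀' σ A)   u = cong (map (σ ⇒_)) (tp-subFm A (exts u))
  tp-subFm (∃' σ A)   u = cong (σ * ∷_) (tp-subFm A (exts u))
  tp-subFm (∀∈ {σ = σ} t A) u = cong (map (σ ⇒_)) (tp-subFm A (exts u))
  tp-subFm (∃∈ t A)   u = tp-subFm A (exts u)

  -- tp (subFm u A) and tp A agree only propositionally, so realizers are
  -- transported between them.
  cast : {Xs Ys : List Ty} → Xs ≡ Ys → Tms Θ Xs → Tms Θ Ys
  cast {Θ} = subst (Tms Θ)

  cast-++⁻ˡ : {Xs Xs' Ys Ys' : List Ty} (e : Xs ≡ Xs') (e' : Ys ≡ Ys') (x : Tms Θ (Xs ++ Ys)) →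
              Allₚ.++⁻ˡ Xs' (cast (cong₂ _++_ e e') x) ≡ cast e (Allₚ.++⁻ˡ Xs x)
  cast-++⁻ˡ refl refl x = refl

  cast-++⁻ʳ : {Xs Xs' Ys Ys' : List Ty} (e : Xs ≡ Xs') (e' : Ys ≡ Ys') (x : Tms Θ (Xs ++ Ys)) →
              Allₚ.++⁻ʳ Xs' (cast (cong₂ _++_ e e') x) ≡ cast e' (Allₚ.++⁻ʳ Xs x)
  cast-++⁻ʳ refl refl x = refl

  cast-∷ : {Xs Ys : List Ty} (e : Xs ≡ Ys) (w : Tm Θ σ) (x : Tms Θ Xs) →
           cast (cong (σ ∷_) e) (w ∷ x) ≡ w ∷ cast e x
  cast-∷ refl w x = refl

  cast-map : {Xs Ys : List Ty} (e : Xs ≡ Ys) (g : ∀ {τ} → Tm Θ τ → Tm Θ' τ) (x : Tms Θ Xs) →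
             All.map g (cast e x) ≡ cast e (All.map g x)
  cast-map refl g x = refl

  cast-appHere : {Xs Ys : List Ty} (e : Xs ≡ Ys) (fs : Tms Θ (map (σ ⇒_) Xs)) →
                 appHere Ys (cast (cong (map (σ ⇒_)) e) fs) ≡ cast e (appHere Xs fs)
  cast-appHere refl fs = refl

  cast-appEach : {Xs Xs' Ys Ys' : List Ty} (e : Xs ≡ Xs') (e' : Ys ≡ Ys')
                 (g : ∀ {τ} → Tm Θ τ → Tm Θ' τ) (fs : Tms Θ (map (Xs ⇛_) Ys)) (as : Tms Θ' Xs) →
                 cast e' (appEach Ys (All.map g fs) as) ≡
                 appEach Ys' (All.map g (cast (cong₂ (λ X Y → map (X ⇛_) Y) e e') fs)) (cast e as)
  cast-appEach refl refl g fs as = refl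

  Alls-reindex : {Xs Ys : List Ty} (e : Ys ≡ Xs) (H : ∀ Zs → Tms (Zs ++ Θ) Xs → Fm (Zs ++ Θ)) →
                 Alls Ys (H Ys (cast e (vars Ys))) ≡ Alls Xs (H Xs (vars Xs))
  Alls-reindex refl H = refl

  Mr-subFm : (A : Fm Γ) (u : Sub Γ Γ') (s : Sub Γ' Θ) (x : Tms Θ (tp (subFm u A))) →
             Mr (subFm u A) s x ≡ Mr A (u ⨾ s) (cast (tp-subFm A u) x)
  Mr-subFm ⊥'         u s x = refl
  Mr-subFm (t ≐ q)    u s x = cong₂ _≐_ (subTm-∘ u s t) (subTm-∘ u s q)
  Mr-subFm (t ∈' q)   u s x = cong₂ _∈'_ (subTm-∘ u s t) (subTm-∘ u s q)
  Mr-subFm (rel R ts) u s x =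
    cong (rel R) (trans (sym (Vecₚ.map-∘ (subTm s) (subTm u) ts)) (Vecₚ.map-cong (subTm-∘ u s) ts))
  Mr-subFm (A ∨' B)   u s x = cong₂ _∨'_
    (trans (Mr-subFm A u s _) (cong (Mr A _) (sym (cast-++⁻ˡ (tp-subFm A u) (tp-subFm B u) x))))
    (trans (Mr-subFm B u s _) (cong (Mr B _) (sym (cast-++⁻ʳ (tp-subFm A u) (tp-subFm B u) x))))
  Mr-subFm (A ∧' B)   u s x = cong₂ _∧'_
    (trans (Mr-subFm A u s _) (cong (Mr A _) (sym (cast-++⁻ˡ (tp-subFm A u) (tp-subFm B u) x))))
    (trans (Mr-subFm B u s _) (cong (Mr B _) (sym (cast-++⁻ʳ (tp-subFm A u) (tp-subFm B u) x))))
  Mr-subFm {Γ' = Γ'} {Θ = Θ} (A ⊃ B) u s f = cong₂ _∧'_ (cong₂ _⊃_ (subFm-∘ u s A) (subFm-∘ u s B)) (begin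
    Alls XA' (Mr A' (wkSubBy XA' s) (vars XA') ⊃
              Mr B' (wkSubBy XA' s) (appEach (tp B') (wkTmsBy XA' f) (vars XA')))
      ≡⟨ cong (Alls XA') (cong₂ _⊃_ (Mr-subFm A u _ _)
           (trans (Mr-subFm B u _ _) (cong (Mr B _) (cast-appEach eA eB (renTm (wkBy XA')) f (vars XA'))))) ⟩
    Alls XA' (H XA' (cast eA (vars XA')))
      ≡⟨ Alls-reindex eA H ⟩
    Alls XA (H XA (vars XA))
      ≡⟨ cong (Alls XA) (cong₂ _⊃_ (Mr-cong A commute _) (Mr-cong B commute _)) ⟩
    Alls XA (Mr A (wkSubBy XA (u ⨾ s)) (vars XA) ⊃
             Mr B (wkSubBy XA (u ⨾ s)) (appEach (tp B) (wkTmsBy XA f') (vars XA))) ∎)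
    where
    open ≡-Reasoning
    A' B' : Fm Γ'
    A' = subFm u A
    B' = subFm u B
    XA XA' : List Ty
    XA  = tp A
    XA' = tp A'
    eA : XA' ≡ XA
    eA = tp-subFm A u
    eB : tp B' ≡ tp B
    eB = tp-subFm B u
    f' : Tms Θ (tp (A ⊃ B))
    f' = cast (tp-subFm (A ⊃ B) u) f
    H : ∀ Zs → Tms (Zs ++ Θ) XA → Fm (Zs ++ Θ)
    H Zs y = Mr A (u ⨾ wkSubBy Zs s) y ⊃ Mr B (u ⨾ wkSubBy Zs s) (appEach (tp B) (wkTmsBy Zs f') y)
    commute : u ⨾ wkSubBy XA s ≗ˢ wkSubBy XA (u ⨾ s)
    commute y = sym (renTm-subTm s (wkBy XA) (u y))
  Mr-subFm (∀' σ A)   u s f = cong (∀' σ) (trans (Mr-subFm A (exts u) (exts s) _)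
    (trans (Mr-cong A (exts-⨾ u s) _) (cong (Mr A _) (sym (cast-appHere (tp-subFm A (exts u)) f)))))
  Mr-subFm (∃' σ A)   u s (w ∷ x) = trans (cong (∃∈ w) (trans (Mr-subFm A (exts u) (exts s) _)
    (trans (Mr-cong A (exts-⨾ u s) _) (cong (Mr A _) (sym (cast-map (tp-subFm A (exts u)) wkTm x))))))
    (cong (Mr (∃' σ A) (u ⨾ s)) (sym (cast-∷ (tp-subFm A (exts u)) w x)))
  Mr-subFm (∀∈ t A)   u s f = cong₂ ∀∈ (subTm-∘ u s t) (trans (Mr-subFm A (exts u) (exts s) _)
    (trans (Mr-cong A (exts-⨾ u s) _) (cong (Mr A _) (sym (cast-appHere (tp-subFm A (exts u)) f)))))
  Mr-subFm (∃∈ t A)   u s x = cong₂ ∃∈ (subTm-∘ u s t) (trans (Mr-subFm A (exts u) (exts s) _)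
    (trans (Mr-cong A (exts-⨾ u s) _) (cong (Mr A _) (sym (cast-map (tp-subFm A (exts u)) wkTm x)))))

  Mr-subFm⁻ : (A : Fm Γ) (u : Sub Γ Γ') (s : Sub Γ' Θ) (x : Tms Θ (tp A)) →
              Mr A (u ⨾ s) x ≡ Mr (subFm u A) s (cast (sym (tp-subFm A u)) x)
  Mr-subFm⁻ A u s x =
    sym (trans (Mr-subFm A u s _) (cong (Mr A (u ⨾ s)) (subst-subst-sym (tp-subFm A u))))

  tp-renFm : (ρ : Ren Γ Γ') (A : Fm Γ) → tp (renFm ρ A) ≡ tp A
  tp-renFm ρ A = trans (cong tp (renFm≡subFm ρ A)) (tp-subFm A (toSub ρ))

  Mr-renFm : (A : Fm Γ) (ρ : Ren Γ Γ') (s : Sub Γ' Θ) (x : Tms Θ (tp (renFm ρ A))) →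
             Mr (renFm ρ A) s x ≡ Mr A (s ∘ ρ) (cast (tp-renFm ρ A) x)
  Mr-renFm A ρ s x = begin
    Mr (renFm ρ A) s x
      ≡⟨ Mr-≡ (renFm≡subFm ρ A) x ⟩
    Mr (subFm (toSub ρ) A) s (cast (cong tp (renFm≡subFm ρ A)) x)
      ≡⟨ Mr-subFm A (toSub ρ) s _ ⟩
    Mr A (s ∘ ρ) (cast (tp-subFm A (toSub ρ)) (cast (cong tp (renFm≡subFm ρ A)) x))
      ≡⟨ cong (Mr A (s ∘ ρ)) (subst-subst (cong tp (renFm≡subFm ρ A))) ⟩
    Mr A (s ∘ ρ) (cast (tp-renFm ρ A) x) ∎
    where
    open ≡-Reasoning
    Mr-≡ : {s : Sub Γ Θ} {A A' : Fm Γ} (e : A ≡ A') (x : Tms Θ (tp A)) →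
           Mr A s x ≡ Mr A' s (cast (cong tp e) x)
    Mr-≡ refl x = refl

  Mr-renFm⁻ : (A : Fm Γ) (ρ : Ren Γ Γ') (s : Sub Γ' Θ) (x : Tms Θ (tp A)) →
              Mr A (s ∘ ρ) x ≡ Mr (renFm ρ A) s (cast (sym (tp-renFm ρ A)) x)
  Mr-renFm⁻ A ρ s x =
    sym (trans (Mr-renFm A ρ s _) (cong (Mr A (s ∘ ρ)) (subst-subst-sym (tp-renFm ρ A))))

  Mr⇒ : (A : Fm Γ) (s : Sub Γ Θ) (x : Tms Θ (tp A)) → Mr A s x ⟹ subFm s A
  Mr⇒ ⊥'         s x       d = d
  Mr⇒ (t ≐ q)    s x       d = d
  Mr⇒ (t ∈' q)   s x       d = d
  Mr⇒ (rel R ts) s x       d = d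
  Mr⇒ (A ∨' B)   s x         = ∨-mono (Mr⇒ A s _) (Mr⇒ B s _)
  Mr⇒ (A ∧' B)   s x         = ∧-mono (Mr⇒ A s _) (Mr⇒ B s _)
  Mr⇒ (A ⊃ B)    s f       d = ∧E₁ d
  Mr⇒ (∀' σ A)   s f         = ∀-mono (Mr⇒ A (exts s) _)
  Mr⇒ (∃' σ A)   s (w ∷ x) d = ∃-mono (Mr⇒ A (exts s) _ ∘ ∧E₂) (∃∈⇒∃ d)
  Mr⇒ (∀∈ t A)   s f         = ∀∈-mono (Mr⇒ A (exts s) _)
  Mr⇒ (∃∈ t A)   s x         = ∃∈-mono (Mr⇒ A (exts s) _)

  ExFree⇒Mr : {A : Fm Γ} → ExFree A → (s : Sub Γ Θ) (x : Tms Θ (tp A)) → subFm s A ⟹ Mr A s x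
  ExFree⇒Mr ef-⊥          s x d = d
  ExFree⇒Mr (ef-≐ t q)    s x d = d
  ExFree⇒Mr (ef-∈ t q)    s x d = d
  ExFree⇒Mr (ef-rel R ts) s x d = d
  ExFree⇒Mr (ef-∨ a b)    s x   = ∨-mono (ExFree⇒Mr a s _) (ExFree⇒Mr b s _)
  ExFree⇒Mr (ef-∧ a b)    s x   = ∧-mono (ExFree⇒Mr a s _) (ExFree⇒Mr b s _)
  ExFree⇒Mr {A = A ⊃ B} (ef-⊃ a b) s f d = ∧I d (Alls-intro (tp A) (⊃I (ExFree⇒Mr b _ _
    (⊃E (wkHyp (≡⇒⟹ (cong₂ _⊃_ (renFm-subFm s _ A) (renFm-subFm s _ B)) (⊢-renFm (wkBy (tp A)) d)))
        (Mr⇒ A _ _ (hyp (here refl)))))))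
  ExFree⇒Mr (ef-∀ a)      s f   = ∀-mono (ExFree⇒Mr a (exts s) _)
  ExFree⇒Mr (ef-∀∈ a)     s f   = ∀∈-mono (ExFree⇒Mr a (exts s) _)
  ExFree⇒Mr (ef-∃∈ a)     s x   = ∃∈-mono (ExFree⇒Mr a (exts s) _)

  Mr-mono : (A : Fm Γ) (s : Sub Γ Θ) {Hs : List (Fm Θ)} {x y : Tms Θ (tp A)} →
            Hs ⊢ x ⊑⋆ y → Hs ⊢ Mr A s x → Hs ⊢ Mr A s y
  Mr-mono ⊥'         s l d = d
  Mr-mono (t ≐ q)    s l d = d
  Mr-mono (t ∈' q)   s l d = d
  Mr-mono (rel R ts) s l d = d
  Mr-mono (A ∨' B)   s l d = ∨E d (∨I₁ (Mr-mono A s (wkHyp (⊑⋆-++⁻ˡ (tp A) l)) (hyp (here refl))))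
                                  (∨I₂ (Mr-mono B s (wkHyp (⊑⋆-++⁻ʳ (tp A) l)) (hyp (here refl))))
  Mr-mono (A ∧' B)   s l d =
    ∧I (Mr-mono A s (⊑⋆-++⁻ˡ (tp A) l) (∧E₁ d)) (Mr-mono B s (⊑⋆-++⁻ʳ (tp A) l) (∧E₂ d))
  Mr-mono (A ⊃ B)    s l d = ∧I (∧E₁ d) (Alls-intro (tp A) (⊃I (Mr-mono B _
    (wkHyp (⊑⋆-appEach (tp B) (⊢-⊑⋆-renFm (map (tp A ⇛_) (tp B)) (wkBy (tp A)) l) (vars (tp A))))
    (⊃E (wkHyp (Alls-unwrap (tp A) (∧E₂ d))) (hyp (here refl))))))
  Mr-mono (∀' σ A)   s l d = ∀I (Mr-mono A (exts s) (⊑⋆-appHere (tp A) l) (∀-unwrap d))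
  Mr-mono (∃' σ A)   s {Hs} {w ∷ x} {w' ∷ y} l d = ∃∈-elim d (∃∈-intro (var here) widen
    (≡⇒⟹ (sym (ext-there-[here] _))
      (Mr-mono A (exts s) (wkHyp (wkHyp (⊢-⊑⋆-renFm (tp A) there (∧E₂ l)))) (hyp (here refl)))))
    where
    widen : Mr A (exts s) (All.map wkTm x) ∷ var here ∈' wkTm w ∷ map wk Hs ⊢ var here ∈' wkTm w'
    widen = ≡⇒⟹ (ext-there-[here] (var here ∈' wkTm w'))
      (∀∈-elim (wkHyp (wkHyp (⊢-wk (∧E₁ l)))) (var here) (hyp (there (here refl))))
  Mr-mono (∀∈ t A)   s l d = ∀∈-intro (Mr-mono A (exts s) (wkHyp (⊑⋆-appHere (tp A) l)) (∀∈-unwrap d))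
  Mr-mono (∃∈ t A)   s l d = ∃∈-elim d (∃∈-intro (var here) (hyp (there (here refl)))
    (≡⇒⟹ (sym (ext-there-[here] _))
      (Mr-mono A (exts s) (wkHyp (wkHyp (⊢-⊑⋆-renFm (tp A) there l))) (hyp (here refl)))))

  Mr-∧-intro : (A B : Fm Γ) (s : Sub Γ Θ) {x : Tms Θ (tp A)} {y : Tms Θ (tp B)} →
               Hs ⊢ Mr A s x → Hs ⊢ Mr B s y → Hs ⊢ Mr (A ∧' B) s (Allₚ.++⁺ x y)
  Mr-∧-intro A B s {x} {y} d e =
    ∧I (≡⇒⟹ (cong (Mr A s) (sym (++⁻ˡ∘++⁺ x y))) d)
       (≡⇒⟹ (cong (Mr B s) (sym (++⁻ʳ∘++⁺ x y))) e)

  Mr-∨-intro₁ : (A B : Fm Γ) (s : Sub Γ Θ) {x : Tms Θ (tp A)} (y : Tms Θ (tp B)) →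
                Hs ⊢ Mr A s x → Hs ⊢ Mr (A ∨' B) s (Allₚ.++⁺ x y)
  Mr-∨-intro₁ A B s {x} y d = ∨I₁ (≡⇒⟹ (cong (Mr A s) (sym (++⁻ˡ∘++⁺ x y))) d)

  Mr-∨-intro₂ : (A B : Fm Γ) (s : Sub Γ Θ) (x : Tms Θ (tp A)) {y : Tms Θ (tp B)} →
                Hs ⊢ Mr B s y → Hs ⊢ Mr (A ∨' B) s (Allₚ.++⁺ x y)
  Mr-∨-intro₂ A B s x {y} d = ∨I₂ (≡⇒⟹ (cong (Mr B s) (sym (++⁻ʳ∘++⁺ x y))) d)

  Mr-⊃-intro : (A B : Fm Γ) (s : Sub Γ Θ) (y : Tms (tp A ++ Θ) (tp B)) →
               Hs ⊢ subFm s A ⊃ subFm s B →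
               Mr A (wkSubBy (tp A) s) (vars (tp A)) ∷ map (renFm (wkBy (tp A))) Hs ⊢
                 Mr B (wkSubBy (tp A) s) y →
               Hs ⊢ Mr (A ⊃ B) s (ΛEach (tp A) (tp B) y)
  Mr-⊃-intro A B s y truth d =
    ∧I truth (Alls-intro (tp A) (⊃I (Mr-mono B _ (⊑⋆-ΛEach (tp A) (tp B) y) d)))

  Mr-⊃-elim : (A B : Fm Γ) (s : Sub Γ Θ) (f : Tms Θ (tp (A ⊃ B))) →
              Hs ⊢ Mr (A ⊃ B) s f → (a : Tms Θ (tp A)) → Hs ⊢ Mr A s a ⊃ Mr B s (appEach (tp B) f a)
  Mr-⊃-elim A B s f d a = ≡⇒⟹ instantiate (Alls-elim (tp A) (∧E₂ d) a)
    where
    XA : List Ty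
    XA = tp A
    unweaken : (t : Tm _ τ) → subTm (a ⊕ var) (renTm (wkBy XA) t) ≡ t
    unweaken t = trans (subTm-renTm (wkBy XA) _ t) (trans (subTm-cong (⊕-wkBy a var) t) (subTm-id t))
    instantiate : subFm (a ⊕ var) (Mr A (wkSubBy XA s) (vars XA) ⊃
                                   Mr B (wkSubBy XA s) (appEach (tp B) (wkTmsBy XA f) (vars XA)))
                  ≡ (Mr A s a ⊃ Mr B s (appEach (tp B) f a))
    instantiate = cong₂ _⊃_
      (trans (subFm-Mr A _ _ _) (trans (Mr-cong A (unweaken ∘ s) _) (cong (Mr A s) (⊕-vars a var))))
      (trans (subFm-Mr B _ _ _) (trans (Mr-cong B (unweaken ∘ s) _) (cong (Mr B s)
        (trans (appEach-subTm (tp B) _ _ _) (cong₂ (appEach (tp B))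
          (trans (Allₚ.map-∘ f) (trans (Allₚ.map-cong f unweaken) (Allₚ.map-id f))) (⊕-vars a var))))))

  Mr-[] : (A : Fm (σ ∷ Γ)) (s : Sub Γ Θ) (t : Tm Γ σ) (z : Tms (σ ∷ Θ) (tp A)) →
          Mr A (exts s) z [ subTm s t ] ≡
          Mr (A [ t ]) s (cast (sym (tp-subFm A (single t))) (All.map (subTm (single (subTm s t))) z))
  Mr-[] A s t z = trans (subFm-Mr A (exts s) _ z) (trans (Mr-cong A pointwise _) (Mr-subFm⁻ A (single t) s _))
    where
    pointwise : exts s ⨾ single (subTm s t) ≗ˢ single t ⨾ s
    pointwise here      = refl
    pointwise (there x) = single-wkTm (subTm s t) (s x)

  Mr-∀-elim : (A : Fm (σ ∷ Γ)) (s : Sub Γ Θ) {f : Tms Θ (tp (∀' σ A))} → Hs ⊢ Mr (∀' σ A) s f →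
              (t : Tm Γ σ) → Σ (Tms Θ (tp (A [ t ]))) (λ x → Hs ⊢ Mr (A [ t ]) s x)
  Mr-∀-elim A s d t = _ , ≡⇒⟹ (Mr-[] A s t _) (∀E d (subTm s t))

  Mr-∃-intro : (A : Fm (σ ∷ Γ)) (s : Sub Γ Θ) (t : Tm Γ σ) {x : Tms Θ (tp (A [ t ]))} →
               Hs ⊢ Mr (A [ t ]) s x →
               Hs ⊢ Mr (∃' σ A) s (con (sng σ) · subTm s t ∷ cast (tp-subFm A (single t)) x)
  Mr-∃-intro {Θ = Θ} A s t {x} d =
    ∃∈-intro (subTm s t) (∈-sng (subTm s t)) (≡⇒⟹ (sym instantiate) d)
    where
    e = tp-subFm A (single t)
    instantiate : Mr A (exts s) (All.map wkTm (cast e x)) [ subTm s t ] ≡ Mr (A [ t ]) s x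
    instantiate = trans (Mr-[] A s t _) (cong (Mr (A [ t ]) s)
      (trans (cong (cast (sym e)) (map-single-wkTm (subTm s t) (cast e x))) (subst-sym-subst {P = Tms Θ} e)))

  Mr-∃-elim : (A : Fm (σ ∷ Γ)) (C : Fm Γ) (s : Sub Γ Θ) {w : Tm Θ (σ *)} {x : Tms Θ (tp A)} →
              Hs ⊢ Mr (∃' σ A) s (w ∷ x) → (c : Tms (σ ∷ Θ) (tp (wk C))) →
              Mr A (exts s) (All.map wkTm x) ∷ var here ∈' wkTm w ∷ map wk Hs ⊢ Mr (wk C) (exts s) c →
              Hs ⊢ Mr C s (⋃⋆ (tp C) w (cast (tp-renFm there C) c))
  Mr-∃-elim A C s {w} d c e = ∃∈-elim d (≡⇒⟹ (sym (renFm-Mr C s there _))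
    (Mr-mono C _ (⊑⋆-⋃⋆ (tp C) w _ (hyp (there (here refl)))) (≡⇒⟹ (Mr-renFm C there (exts s) c) e)))

  Mr-⊃-const : (A B : Fm Γ) (s : Sub Γ Θ) (y : Tms Θ (tp B)) →
               Hs ⊢ subFm s A ⊃ subFm s B → Hs ⊢ subFm s A ⊃ Mr B s y →
               Hs ⊢ Mr (A ⊃ B) s (ΛEach (tp A) (tp B) (wkTmsBy (tp A) y))
  Mr-⊃-const A B s y truth d = Mr-⊃-intro A B s _ truth (⊃E
    (wkHyp (≡⇒⟹ (cong₂ _⊃_ (renFm-subFm s _ A) (renFm-Mr B s _ y)) (⊢-renFm (wkBy (tp A)) d)))
    (Mr⇒ A _ _ (hyp (here refl))))

  Mr-⊃-ExFree-elim : {A : Fm Γ} (B : Fm Γ) → ExFree A → (s : Sub Γ Θ) (f : Tms Θ (tp (A ⊃ B))) →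
                     Hs ⊢ Mr (A ⊃ B) s f → Hs ⊢ subFm s A ⊃ Mr B s (appEach (tp B) f (inhs (tp A)))
  Mr-⊃-ExFree-elim {A = A} B ef s f d =
    ⊃-mono (ExFree⇒Mr ef s _) (λ h → h) (Mr-⊃-elim A B s f d (inhs (tp A)))

module AxiomRealizers (L : Language) (T : Syn.Theory L) where
  open Syn L
  open Substitution L
  open DerivedRules L T
  open Combinators L T
  open Majorizability L T
  open Realizability L T

  private variable
    Γ Θ : Ctx
    σ τ : Ty

  UniformlyRealized : Fm Γ → Set
  UniformlyRealized {Γ} A =
    ∀ {Θ} (s : Sub Γ Θ) → Σ (Tms Θ (tp A)) (λ x → ∀ {Hs : List (Fm Θ)} → Hs ⊢ Mr A s x)

  ExFree-realized : {A : Fm Γ} → ExFree A → Ax A → UniformlyRealized A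
  ExFree-realized ef a s = inhs _ , ExFree⇒Mr ef s _ (ax (Ax-subFm s a))

  infix 4 _↝_

  _↝_ : Fm Γ → Fm Γ → Set
  _↝_ {Γ} P Q =
    ∀ {Θ} (s : Sub Γ Θ) (x : Tms Θ (tp P)) → Σ (Tms Θ (tp Q)) (λ y → Mr P s x ⟹ Mr Q s y)

  realized-⊃ : (P Q : Fm Γ) → (∀ {Θ} (s : Sub Γ Θ) {Hs : List (Fm Θ)} → Hs ⊢ subFm s (P ⊃ Q)) →
               P ↝ Q → UniformlyRealized (P ⊃ Q)
  realized-⊃ P Q true f {Θ} s = ΛEach (tp P) (tp Q) (proj₁ transformed) ,
    Mr-⊃-intro P Q s _ (true s) (proj₂ transformed (hyp (here refl)))
    where
    transformed : Σ (Tms (tp P ++ Θ) (tp Q))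
                    (λ y → Mr P (wkSubBy (tp P) s) (vars (tp P)) ⟹ Mr Q (wkSubBy (tp P) s) y)
    transformed = f (wkSubBy (tp P) s) (vars (tp P))

  realized-⇔ : (P Q : Fm Γ) → (∀ {Θ} (s : Sub Γ Θ) {Hs : List (Fm Θ)} → Hs ⊢ subFm s (P ⇔ Q)) →
               P ↝ Q → Q ↝ P → UniformlyRealized (P ⇔ Q)
  realized-⇔ P Q true to from {Θ} s =
    Allₚ.++⁺ (proj₁ forth) (proj₁ back) , Mr-∧-intro (P ⊃ Q) (Q ⊃ P) s (proj₂ forth) (proj₂ back)
    where
    forth : Σ (Tms Θ (tp (P ⊃ Q))) (λ x → ∀ {Hs : List (Fm Θ)} → Hs ⊢ Mr (P ⊃ Q) s x)
    forth = realized-⊃ P Q (λ s → ∧E₁ (true s)) to s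
    back : Σ (Tms Θ (tp (Q ⊃ P))) (λ x → ∀ {Hs : List (Fm Θ)} → Hs ⊢ Mr (Q ⊃ P) s x)
    back = realized-⊃ Q P (λ s → ∧E₂ (true s)) from s


  []⇛-id : (Ys : List Ty) → map ([] ⇛_) Ys ≡ Ys
  []⇛-id = Listₚ.map-id

  appEach-[] : (Ys : List Ty) (fs : Tms Θ (map ([] ⇛_) Ys)) →
               appEach Ys (wkTmsBy [] fs) [] ≡ cast ([]⇛-id Ys) fs
  appEach-[] []       []       = refl
  appEach-[] (τ ∷ Ys) (f ∷ fs) =
    trans (cong₂ _∷_ (renTm-id f) (appEach-[] Ys fs)) (sym (cast-∷ ([]⇛-id Ys) f fs))

  Mr-∈⊃ : (a : Tm Γ σ) (b : Tm Γ (σ *)) (B : Fm Γ) (s : Sub Γ Θ) (g : Tms Θ (tp (a ∈' b ⊃ B))) →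
          Mr (a ∈' b ⊃ B) s g ≡
          subFm s (a ∈' b ⊃ B) ∧' (subFm s (a ∈' b) ⊃ Mr B s (cast ([]⇛-id (tp B)) g))
  Mr-∈⊃ a b B s g = cong (subFm s (a ∈' b ⊃ B) ∧'_) (cong₂ _⊃_
    (cong₂ _∈'_ (subTm-cong (renTm-id ∘ s) a) (subTm-cong (renTm-id ∘ s) b))
    (trans (Mr-cong B (renTm-id ∘ s) _) (cong (Mr B s) (appEach-[] (tp B) g))))

  ∀∈-def-realized : (t : Tm Γ (σ *)) (A : Fm (σ ∷ Γ)) →
                    UniformlyRealized (∀∈ t A ⇔ ∀' σ (var here ∈' wkTm t ⊃ A))
  ∀∈-def-realized {Γ = Γ} {σ = σ} t A = realized-⇔ P Q (λ s → ax (Ax-subFm s (∀∈-def t A))) to from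
    where
    P Q : Fm Γ
    P = ∀∈ t A
    Q = ∀' σ (var here ∈' wkTm t ⊃ A)
    e : tp Q ≡ tp P
    e = cong (map (σ ⇒_)) ([]⇛-id (tp A))
    unfold : (s : Sub _ Θ) (g : Tms Θ (tp Q)) →
             Mr Q s g ≡ ∀' σ ((var here ∈' wkTm (subTm s t) ⊃ subFm (exts s) A) ∧'
                              (var here ∈' wkTm (subTm s t) ⊃ Mr A (exts s) (appHere (tp A) (cast e g))))
    unfold s g = cong (∀' σ) (trans (Mr-∈⊃ (var here) (wkTm t) A (exts s) _)
      (cong₂ (λ X Y → (var here ∈' X ⊃ _) ∧' (var here ∈' X ⊃ Mr A (exts s) Y))
        (wkTm-subTm s t) (sym (cast-appHere ([]⇛-id (tp A)) g))))
    to : P ↝ Q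
    to s f = cast (sym e) f , λ d → ≡⇒⟹ (sym (unfold s _)) (∀-mono (λ h →
      ∧I (⊃-mono (λ m → m) (Mr⇒ A _ _) h)
         (≡⇒⟹ (cong (λ X → _ ⊃ Mr A (exts s) (appHere (tp A) X)) (sym (subst-subst-sym e))) h)) (∀∈⇒∀ d))
    from : Q ↝ P
    from s g = cast e g , λ d → ∀⇒∀∈ (∀-mono ∧E₂ (≡⇒⟹ (unfold s g) d))

  ∃∈-def-realized : (t : Tm Γ (σ *)) (A : Fm (σ ∷ Γ)) →
                    UniformlyRealized (∃∈ t A ⇔ ∃' σ (var here ∈' wkTm t ∧' A))
  ∃∈-def-realized {Γ = Γ} {σ = σ} t A = realized-⇔ P Q (λ s → ax (Ax-subFm s (∃∈-def t A))) to from
    where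
    P Q : Fm Γ
    P = ∃∈ t A
    Q = ∃' σ (var here ∈' wkTm t ∧' A)
    to : P ↝ Q
    to s x = subTm s t ∷ x , ∃⇒∃∈ ∘ ∃-mono (λ h →
      ∧I (∧E₁ h) (∧I (≡⇒⟹ (cong (var here ∈'_) (sym (wkTm-subTm s t))) (∧E₁ h)) (∧E₂ h))) ∘ ∃∈⇒∃
    from : Q ↝ P
    from s (w ∷ x) = x , λ d → ∃∈-elim d (∃∈-intro (var here)
      (≡⇒⟹ (cong (var here ∈'_) (wkTm-subTm s t)) (∧E₁ (hyp (here refl))))
      (≡⇒⟹ (sym (ext-there-[here] _)) (∧E₂ (hyp (here refl)))))

  subTm-wk³ : ∀ {α β γ} (g : Tm Γ γ) (h : Tm Γ τ) →
              subTm (exts {σ = α} (exts {σ = β} (single g))) (wkTm (wkTm (wkTm h))) ≡ wkTm (wkTm h)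
  subTm-wk³ g h = trans (wkTm-subTm _ (wkTm (wkTm h)))
                        (cong wkTm (trans (wkTm-subTm _ (wkTm h)) (cong wkTm (single-wkTm g h))))

  appHere-wk³ : ∀ {α β γ} (g : Tm Γ γ) (Ys : List Ty) (hs : Tms Γ (map (β ⇒_) Ys)) →
                All.map (subTm (exts {σ = α} (exts {σ = β} (single g))))
                        (All.map wkTm (appHere Ys (All.map wkTm hs)))
                ≡ All.map wkTm (appHere Ys hs)
  appHere-wk³ g []       []       = refl
  appHere-wk³ g (τ ∷ Ys) (h ∷ hs) =
    cong₂ _∷_ (cong (_· var (there here)) (subTm-wk³ g h)) (appHere-wk³ g Ys hs)

  AC-realized : ∀ {Γ ρ σ} (A : Fm (σ ∷ ρ ∷ Γ)) →
                UniformlyRealized (∀' ρ (∃' σ A) ⊃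
                                   ∃' (ρ ⇒ σ *) (∀' ρ (∃∈ (var (there here) · var here) (renFm (ext (ext there)) A))))
  AC-realized {Γ} {ρ} {σ} A = realized-⊃ (∀' ρ (∃' σ A)) _ (λ s → ax (Ax-subFm s (AC A))) choice
    where
    r : Ren (σ ∷ ρ ∷ Γ) (σ ∷ ρ ∷ (ρ ⇒ σ *) ∷ Γ)
    r = ext (ext there)
    A'' : Fm (σ ∷ ρ ∷ (ρ ⇒ σ *) ∷ Γ)
    A'' = renFm r A
    E : ∀ {Ys} → Ys ≡ tp A → map (ρ ⇒_) (tp A) ≡ map (ρ ⇒_) Ys
    E e = cong (map (ρ ⇒_)) (sym e)
    uncast : ∀ {Θ Ys} {S : Sub (σ ∷ ρ ∷ (ρ ⇒ σ *) ∷ Θ) (σ ∷ ρ ∷ Θ)} (e : Ys ≡ tp A)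
             (hs : Tms Θ (map (ρ ⇒_) (tp A))) →
             cast e (All.map (subTm S) (All.map wkTm (appHere Ys (All.map wkTm (cast (E e) hs)))))
             ≡ All.map (subTm S) (All.map wkTm (appHere (tp A) (All.map wkTm hs)))
    uncast refl hs = refl
    choice : ∀' ρ (∃' σ A) ↝ _
    choice {Θ} s (g ∷ hs) = con (sng _) · g ∷ hs'' ,
      λ d → ∃∈-intro g (∈-sng g) (∀-mono (∃∈-mono (≡⇒⟹ (sym unfold))) d)
      where
      hs'' : Tms Θ (map (ρ ⇒_) (tp A''))
      hs'' = cast (E (tp-renFm r A)) hs
      S : Sub (σ ∷ ρ ∷ (ρ ⇒ σ *) ∷ Θ) (σ ∷ ρ ∷ Θ)
      S = exts (exts (single g))
      pointwise : (exts (exts (exts s)) ⨾ S) ∘ r ≗ˢ exts (exts s)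
      pointwise here              = refl
      pointwise (there here)      = refl
      pointwise (there (there x)) = subTm-wk³ g (s x)
      unfold : subFm S (Mr A'' (exts (exts (exts s))) (All.map wkTm (appHere (tp A'') (All.map wkTm hs''))))
               ≡ Mr A (exts (exts s)) (All.map wkTm (appHere (tp A) hs))
      unfold = trans (subFm-Mr A'' _ S _) (trans (Mr-renFm A r _ _) (trans (Mr-cong A pointwise _)
        (cong (Mr A _) (trans (uncast (tp-renFm r A) hs) (appHere-wk³ g (tp A) hs)))))

  IP-realized : (B : Fm Γ) → ExFree B → (A : Fm (σ ∷ Γ)) →
                UniformlyRealized ((B ⊃ ∃' σ A) ⊃ ∃' (σ *) (wk B ⊃ ∃∈ (var here) (renFm (ext there) A)))
  IP-realized {Γ = Γ} {σ = σ} B ef A =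
    realized-⊃ (B ⊃ ∃' σ A) _ (λ s → ax (Ax-subFm s (IP B ef A))) independence
    where
    A' : Fm (σ ∷ σ * ∷ Γ)
    A' = renFm (ext there) A
    C : Fm (σ * ∷ Γ)
    C = ∃∈ (var here) A'
    -- The witness set and the realizer of the conclusion are read off at an
    -- arbitrary realizer of the ∃-free premise B.
    independence : (B ⊃ ∃' σ A) ↝ ∃' (σ *) (wk B ⊃ C)
    independence {Θ} s (w ∷ ys) = con (sng _) · S₀ ∷ K , realizes
      where
      S₀ : Tm Θ (σ *)
      S₀ = appAll w (inhs (tp B))
      Y  : Tms Θ (tp A)
      Y  = appEach (tp A) ys (inhs (tp B))
      Y' : Tms Θ (tp A')
      Y' = cast (sym (tp-renFm (ext there) A)) Y
      K  : Tms Θ (map (tp (wk B) ⇛_) (tp A'))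
      K  = ΛEach (tp (wk B)) (tp A') (wkTmsBy (tp (wk B)) Y')
      S' : Sub (σ * ∷ Γ) Θ
      S' = exts s ⨾ single S₀
      S'-there : S' ∘ there ≗ˢ s
      S'-there x = single-wkTm S₀ (s x)
      S'-ext : exts S' ∘ ext there ≗ˢ exts s
      S'-ext here      = refl
      S'-ext (there x) = cong wkTm (S'-there x)
      B-at-S' : subFm S' (wk B) ≡ subFm s B
      B-at-S' = trans (subFm-renFm there S' B) (subFm-cong S'-there B)
      C-at-S' : subFm S' C ≡ ∃∈ S₀ (subFm (exts s) A)
      C-at-S' = cong (∃∈ S₀) (trans (subFm-renFm (ext there) (exts S') A) (subFm-cong S'-ext A))
      Mr-C-at-S' : Mr C S' Y' ≡ ∃∈ S₀ (Mr A (exts s) (All.map wkTm Y))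
      Mr-C-at-S' = cong (∃∈ S₀) (trans (Mr-renFm A (ext there) (exts S') _) (trans (Mr-cong A S'-ext _)
        (cong (Mr A (exts s)) (trans (sym (cast-map (tp-renFm (ext there) A) wkTm _))
          (cong (All.map wkTm) (subst-subst-sym (tp-renFm (ext there) A)))))))
      instantiate : Mr (wk B ⊃ C) (exts s) (All.map wkTm K) [ S₀ ] ≡ Mr (wk B ⊃ C) S' K
      instantiate = trans (subFm-Mr (wk B ⊃ C) (exts s) (single S₀) _)
                          (cong (Mr (wk B ⊃ C) S') (map-single-wkTm S₀ K))
      realizes : Mr (B ⊃ ∃' σ A) s (w ∷ ys) ⟹ Mr (∃' (σ *) (wk B ⊃ C)) s (con (sng _) · S₀ ∷ K)
      realizes {Hs} d = ∃∈-intro S₀ (∈-sng S₀) (≡⇒⟹ (sym instantiate) (Mr-⊃-const (wk B) C S' Y'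
        (≡⇒⟹ (cong₂ _⊃_ (sym B-at-S') (sym C-at-S')) (⊃-mono (λ h → h) (∃∈-mono (Mr⇒ A _ _)) premise))
        (≡⇒⟹ (cong₂ _⊃_ (sym B-at-S') (sym Mr-C-at-S')) premise)))
        where
        premise : Hs ⊢ subFm s B ⊃ Mr (∃' σ A) s (S₀ ∷ Y)
        premise = Mr-⊃-ExFree-elim (∃' σ A) ef s (w ∷ ys) d

  Ax-realized : {A : Fm Γ} → Ax A → UniformlyRealized A
  Ax-realized a@(eq-refl t)         = ExFree-realized (ef-≐ _ _) a
  Ax-realized a@(eq-subst A at t u) = ExFree-realized
    (ef-⊃ (ef-∧ (ef-≐ _ _) (Atomic⇒ExFree (Atomic-subFm (single t) at))) (Atomic⇒ExFree (Atomic-subFm (single u) at))) a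
  Ax-realized (∀∈-def t A)          = ∀∈-def-realized t A
  Ax-realized (∃∈-def t A)          = ∃∈-def-realized t A
  Ax-realized a@(Σ-ax x y z)        = ExFree-realized (ef-≐ _ _) a
  Ax-realized a@(Π-ax x y)          = ExFree-realized (ef-≐ _ _) a
  Ax-realized a@(sng-ax w x)        =
    ExFree-realized (ef-∧ (ef-⊃ (ef-∈ _ _) (ef-≐ _ _)) (ef-⊃ (ef-≐ _ _) (ef-∈ _ _))) a
  Ax-realized a@(cup-ax w x y)      = ExFree-realized
    (ef-∧ (ef-⊃ (ef-∈ _ _) (ef-∨ (ef-∈ _ _) (ef-∈ _ _))) (ef-⊃ (ef-∨ (ef-∈ _ _) (ef-∈ _ _)) (ef-∈ _ _))) a
  Ax-realized a@(bigcup-ax z x w y) = ExFree-realized (ef-⊃ (ef-∧ (ef-∈ _ _) (ef-∈ _ _)) (ef-∈ _ _)) a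
  Ax-realized a@(bigcup-sng x y)    = ExFree-realized (ef-≐ _ _) a
  Ax-realized a@(bigcup-cup x y z)  = ExFree-realized (ef-≐ _ _) a
  Ax-realized (AC A)                = AC-realized A
  Ax-realized (IP B ef A)           = IP-realized B ef A

module Soundness (L : Language) (T : Syn.Theory L) (T-ExFree : ∀ B → T B → Syn.ExFree L B) where
  open Syn L
  open Substitution L
  open DerivedRules L T
  open Combinators L T
  open Majorizability L T
  open Realizability L T
  open AxiomRealizers L T

  private variable
    Γ Θ Θ' : Ctx
    σ : Ty
    Δ : List (Fm Γ)
    s : Sub Γ Θ
    Hs Hs' : List (Fm Θ)

  Realized : List (Fm Γ) → Sub Γ Θ → List (Fm Θ) → Set
  Realized {Θ = Θ} Δ s Hs = ∀ {D} → D ∈ Δ → Σ (Tms Θ (tp D)) (λ y → Hs ⊢ Mr D s y)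

  Realized-∷ : (A : Fm Γ) (x : Tms Θ (tp A)) → Realized Δ s Hs → Realized (A ∷ Δ) s (Mr A s x ∷ Hs)
  Realized-∷ A x env (here refl) = x , hyp (here refl)
  Realized-∷ A x env (there p)   = proj₁ (env p) , wkHyp (proj₂ (env p))

  Realized-weaken : Hs ⊆ Hs' → Realized Δ s Hs → Realized Δ s Hs'
  Realized-weaken sub env p = proj₁ (env p) , weaken sub (proj₂ (env p))

  Realized-renFm : (ρ : Ren Θ Θ') → Realized Δ s Hs → Realized Δ (renTm ρ ∘ s) (map (renFm ρ) Hs)
  Realized-renFm {s = s} ρ env {D} p =
    All.map (renTm ρ) (proj₁ (env p)) , ≡⇒⟹ (renFm-Mr D s ρ _) (⊢-renFm ρ (proj₂ (env p)))

  Realized-wk : Realized Δ s Hs → Realized (map (wk {τ = σ}) Δ) (exts s) (map wk Hs)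
  Realized-wk {s = s} env q with ∈-map⁻ wk q
  ... | D , p , refl = _ , ≡⇒⟹ (Mr-renFm⁻ D there (exts s) _) (proj₂ (Realized-renFm there env p))

  Realized⇒true : Realized Δ s Hs → ∀ {D'} → D' ∈ map (subFm s) Δ → Hs ⊢ D'
  Realized⇒true {s = s} env q with ∈-map⁻ (subFm s) q
  ... | D , p , refl = Mr⇒ D s _ (proj₂ (env p))

  soundness : ∀ {A} → Δ ⊢ A → (s : Sub Γ Θ) (Hs : List (Fm Θ)) →
              Realized Δ s Hs → Σ (Tms Θ (tp A)) (λ x → Hs ⊢ Mr A s x)
  soundness (hyp p) s Hs env = env p
  soundness (ax a)  s Hs env = proj₁ (Ax-realized a s) , proj₂ (Ax-realized a s)
  soundness (thy {B = B} b) s Hs env =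
    inhs _ , ExFree⇒Mr (ExFree-renFm fromEmpty (T-ExFree B b)) s _ (≡⇒⟹ (sym (subFm-closed s B)) (thy b))
  soundness (⊥E d) s Hs env = inhs _ , ⊥E (proj₂ (soundness d s Hs env))
  soundness (∧I {A = A} {B} d e) s Hs env with soundness d s Hs env | soundness e s Hs env
  ... | x , dx | y , ey = Allₚ.++⁺ x y , Mr-∧-intro A B s dx ey
  soundness (∧E₁ {A = A} d) s Hs env with soundness d s Hs env
  ... | x , dx = Allₚ.++⁻ˡ (tp A) x , ∧E₁ dx
  soundness (∧E₂ {A = A} d) s Hs env with soundness d s Hs env
  ... | x , dx = Allₚ.++⁻ʳ (tp A) x , ∧E₂ dx
  soundness (∨I₁ {A = A} {B} d) s Hs env with soundness d s Hs env
  ... | x , dx = Allₚ.++⁺ x (inhs (tp B)) , Mr-∨-intro₁ A B s _ dx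
  soundness (∨I₂ {A = A} {B} d) s Hs env with soundness d s Hs env
  ... | y , dy = Allₚ.++⁺ (inhs (tp A)) y , Mr-∨-intro₂ A B s _ dy
  soundness (∨E {A = A} {B} {C} d e f) s Hs env with soundness d s Hs env
  ... | x , dx with soundness e s _ (Realized-∷ A (Allₚ.++⁻ˡ (tp A) x) env)
                  | soundness f s _ (Realized-∷ B (Allₚ.++⁻ʳ (tp A) x) env)
  ... | y , ey | z , fz =
    y ⊔⋆ z , ∨E dx (Mr-mono C s (⊑⋆-⊔⋆ˡ (tp C) y z) ey) (Mr-mono C s (⊑⋆-⊔⋆ʳ (tp C) y z) fz)
  soundness (⊃I {Δ = Δ} {A} {B} d) s Hs env
    with soundness d (wkSubBy (tp A) s) _ (Realized-∷ A (vars (tp A)) (Realized-renFm (wkBy (tp A)) env))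
  ... | y , dy = ΛEach (tp A) (tp B) y , Mr-⊃-intro A B s y (⊃I (cut hyps (⊢-subFm d s))) dy
    where
    hyps : ∀ {D'} → D' ∈ map (subFm s) (A ∷ Δ) → subFm s A ∷ Hs ⊢ D'
    hyps (here refl) = hyp (here refl)
    hyps (there q)   = wkHyp (Realized⇒true env q)
  soundness (⊃E {A = A} {B} d e) s Hs env with soundness d s Hs env | soundness e s Hs env
  ... | f , df | a , ea = appEach (tp B) f a , ⊃E (Mr-⊃-elim A B s f df a) ea
  soundness (∀I {A = A} d) s Hs env with soundness d (exts s) (map wk Hs) (Realized-wk env)
  ... | x , dx = lamEach (tp A) x , ∀I (Mr-mono A (exts s) (⊑⋆-lamEach (tp A) x) dx)
  soundness (∀E {A = A} d t) s Hs env = Mr-∀-elim A s (proj₂ (soundness d s Hs env)) t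
  soundness (∃I {A = A} t d) s Hs env with soundness d s Hs env
  ... | x , dx = _ ∷ _ , Mr-∃-intro A s t dx
  soundness (∃E {A = A} {C} d e) s Hs env with soundness d s Hs env
  ... | w ∷ x , dx
    with soundness e (exts s) _ (Realized-∷ A (All.map wkTm x) (Realized-weaken (⊆ₚ.xs⊆x∷xs _ _) (Realized-wk env)))
  ... | c , ec = _ , Mr-∃-elim A C s dx c ec

module Extraction (L : Language) (T : Syn.Theory L) where
  open Syn L
  open Substitution L
  open DerivedRules L T
  open Combinators L T using (appHere)
  open Realizability L T

  private variable
    Γ Θ : Ctx
    σ τ : Ty

  applyTo : (Zs : Ctx) → Ren Zs Γ → Tm [] (Zs ⇛ τ) → Tm Γ τ
  applyTo Zs ρ r = appVars Zs ρ (closed r)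

  renTm-appVars : (Zs : Ctx) (ρ' : Ren Zs Γ) (ρ : Ren Γ Θ) (t : Tm Γ (Zs ⇛ τ)) →
                  renTm ρ (appVars Zs ρ' t) ≡ appVars Zs (ρ ∘ ρ') (renTm ρ t)
  renTm-appVars []       ρ' ρ t = refl
  renTm-appVars (σ ∷ Zs) ρ' ρ t = cong (_· var (ρ (ρ' here))) (renTm-appVars Zs (ρ' ∘ there) ρ t)

  renTm-applyTo : (Zs : Ctx) (ρ' : Ren Zs Γ) (ρ : Ren Γ Θ) (r : Tm [] (Zs ⇛ τ)) →
                  renTm ρ (applyTo Zs ρ' r) ≡ applyTo Zs (ρ ∘ ρ') r
  renTm-applyTo Zs ρ' ρ r =
    trans (renTm-appVars Zs ρ' ρ (closed r)) (cong (appVars Zs (ρ ∘ ρ')) (renTm-closed ρ r))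

  curried : ∀ (Zs : Ctx) (E : Fm Zs) → Tms [] (tp (∀s Zs E)) → All (λ τ → Tm [] (Zs ⇛ τ)) (tp E)
  curried []       E x = x
  curried (σ ∷ Zs) E x = Allₚ.map⁻ (curried Zs (∀' σ E) x)

  Mr-∀s : ∀ (Zs : Ctx) (E C : Fm Zs) (x : Tms [] (tp (∀s Zs E))) →
          Mr E var (All.map (applyTo Zs id) (curried Zs E x)) ⟹ C →
          [] ⊢ Mr (∀s Zs E) var x → [] ⊢ ∀s Zs C
  Mr-∀s []       E C x f =
    f ∘ ≡⇒⟹ (cong (Mr E var) (sym (trans (Allₚ.map-cong x closed-id) (Allₚ.map-id x))))
  Mr-∀s (σ ∷ Zs) E C x f = Mr-∀s Zs (∀' σ E) (∀' σ C) x (∀-mono (f ∘ ≡⇒⟹ (trans (Mr-cong E exts-var _)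
    (cong (Mr E var) (appHere-applyTo (tp E) (curried Zs (∀' σ E) x))))))
    where
    appHere-applyTo : ∀ (Ys : List Ty) (rs : All (λ τ → Tm [] (Zs ⇛ τ)) (map (σ ⇒_) Ys)) →
                      appHere Ys (All.map (applyTo Zs id) rs) ≡ All.map (applyTo (σ ∷ Zs) id) (Allₚ.map⁻ rs)
    appHere-applyTo []       []       = refl
    appHere-applyTo (τ ∷ Ys) (r ∷ rs) =
      cong₂ _∷_ (cong (_· var here) (renTm-applyTo Zs id there r)) (appHere-applyTo Ys rs)

  module _ (Zs : Ctx) where

    splitBounds : ∀ {P : Ty → Set} (Ws : Ctx) (A : Fm (Ws ++ Zs)) →
                  All P (tp (∃s Ws A)) → All (λ τ → P (τ *)) Ws × All P (tp A)
    splitBounds []       A x = [] , x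
    splitBounds (σ ∷ Ws) A x with splitBounds Ws (∃' σ A) x
    ... | rs , (r ∷ rest) = (r ∷ rs) , rest

    Mr-∃s : ∀ (Ws : Ctx) (A C : Fm (Ws ++ Zs)) (x : All (λ τ → Tm [] (Zs ⇛ τ)) (tp (∃s Ws A))) →
            Mr A var (All.map (applyTo Zs (wkBy Ws)) (proj₂ (splitBounds Ws A x))) ⟹ C →
            Mr (∃s Ws A) var (All.map (applyTo Zs id) x) ⟹ ∃∈s Ws (proj₁ (splitBounds Ws A x)) C
    Mr-∃s []       A C x f = f
    Mr-∃s (σ ∷ Ws) A C x f with splitBounds Ws (∃' σ A) x | (λ C' → Mr-∃s Ws (∃' σ A) C' x)
    ... | rs , (r ∷ rest) | peel = peel (∃∈ (applyTo Zs (wkBy Ws) r) C) (∃∈-mono (f ∘ ≡⇒⟹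
      (trans (Mr-cong A exts-var _)
             (cong (Mr A var) (trans (Allₚ.map-∘ rest) (Allₚ.map-cong rest (renTm-applyTo Zs (wkBy Ws) there)))))))

corollary1 : (L : Language) → let open Syn L in
    (T : Theory) → (∀ B → T B → ExFree B) →
    (Zs Ws : Ctx) (A : Fm (Ws ++ Zs)) →
    T ∣ [] ⊢ ∀s Zs (∃s Ws A) →
    Σ (All (λ τ → Tm [] (Zs ⇛ τ *)) Ws) (λ rs → T ∣ [] ⊢ ∀s Zs (∃∈s Ws rs A))
corollary1 L T T-ExFree Zs Ws A d =
  bounds , Mr-∀s Zs (∃s Ws A) _ realizer (Mr-∃s Zs Ws A A _ truth) realizes
  where
  open Syn L
  open Substitution L
  open DerivedRules L T
  open Realizability L T
  open Soundness L T T-ExFree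
  open Extraction L T

  realized : Σ (Tms [] (tp (∀s Zs (∃s Ws A)))) (λ x → [] ⊢ Mr (∀s Zs (∃s Ws A)) var x)
  realized = soundness d var [] (λ ())

  realizer : Tms [] (tp (∀s Zs (∃s Ws A)))
  realizer = proj₁ realized

  realizes : [] ⊢ Mr (∀s Zs (∃s Ws A)) var realizer
  realizes = proj₂ realized

  bounds : All (λ τ → Tm [] (Zs ⇛ τ *)) Ws
  bounds = proj₁ (splitBounds Zs Ws A (curried Zs (∃s Ws A) realizer))


  truth : ∀ {x} → Mr A var x ⟹ A
  truth = ≡⇒⟹ (subFm-id A) ∘ Mr⇒ A var _
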